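{- Let $G$ be an $n$-vertex graph in which every pair of non-adjacent vertices $u,v$ satisfies $\deg(u)+\deg(v)\ge n+3$. Alternatively, let $G$ be a balanced bipartite graph on $2n$ vertices in which every pair of non-adjacent vertices $u,v$ lying in different halves of the bipartition satisfies $\deg(u)+\deg(v)\ge n+1$. Then any two perfect matchings $M,M'$ of $G$ with $|M\,\Delta\,M'|\le 8$ are equivalent via $3$-switches, i.e. there is a sequence $M=N_0,N_1,\dots,N_t=M'$ of perfect matchings of $G$ with $|N_{i-1}\,\Delta\,N_i|\le 6$ for all $i\in[t]$. -}

module Defs where

open import Data.Nat using (ℕ; _+_; _≤_; _<_)
open import Data.Bool using (Bool; true; false; _xor_; not; _∧_)
open import Data.Fin using (Fin; toℕ)
open import Data.List using (List; length; filter; map)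
open import Data.Nat.ListAction using (sum)
open import Data.Fin using () renaming (_<?_ to _<ᶠ?_)
open import Data.List using (allFin)
open import Relation.Binary.PropositionalEquality using (_≡_; _≢_)
open import Relation.Nullary.Decidable using (does)
open import Relation.Binary.Construct.Closure.ReflexiveTransitive using (Star)
open import Data.Bool.Properties using (T?)
open import Data.Product using (_×_)

count : {n : ℕ} → (Fin n → Bool) → ℕ
count {n} p = length (filter (λ i → T? (p i)) (allFin n))

countPairs : {n : ℕ} → (Fin n → Fin n → Bool) → ℕ
countPairs {n} r = sum (map (λ u → count (λ v → does (u <ᶠ? v) ∧ r u v)) (allFin n))

record Graph (n : ℕ) : Set where
  field
    adj     : Fin n → Fin n → Bool
    adj-sym : ∀ u v → adj u v ≡ adj v u
    irrefl  : ∀ v → adj v v ≡ false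
open Graph public

deg : {n : ℕ} → Graph n → Fin n → ℕ
deg G v = count (adj G v)

record PerfectMatching {n : ℕ} (G : Graph n) : Set where
  field
    edge     : Fin n → Fin n → Bool
    edge-sym : ∀ u v → edge u v ≡ edge v u
    edge-adj : ∀ u v → edge u v ≡ true → adj G u v ≡ true
    perfect  : ∀ v → count (edge v) ≡ 1
open PerfectMatching public

symDiff : {n : ℕ} {G : Graph n} → PerfectMatching G → PerfectMatching G → ℕ
symDiff M M' = countPairs (λ u v → edge M u v xor edge M' u v)

Switch3 : {n : ℕ} {G : Graph n} → PerfectMatching G → PerfectMatching G → Set
Switch3 N N' = symDiff N N' ≤ 6

Conclusion : {n : ℕ} → Graph n → Set
Conclusion G = ∀ (M M' : PerfectMatching G) → symDiff M M' ≤ 8 → Star Switch3 M M'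

OreCondition : {n : ℕ} → Graph n → ℕ → Set
OreCondition G k = ∀ u v → u ≢ v → adj G u v ≡ false → k ≤ deg G u + deg G v

BalancedBipartition : (n : ℕ) → Graph (n + n) → (Fin (n + n) → Bool) → Set
BalancedBipartition n G side =
  (count side ≡ n) × (∀ u v → adj G u v ≡ true → side u ≢ side v)


BipOreCondition : (n : ℕ) → Graph (n + n) → (Fin (n + n) → Bool) → ℕ → Set
BipOreCondition n G side k =
  ∀ u v → side u ≢ side v → adj G u v ≡ false → k ≤ deg G u + deg G v

{-# OPTIONS --safe #-}
module Submission where

open import Defs
open import Data.Nat using (ℕ; zero; suc; _+_; _*_; _∸_; _≤_; _<_; _≤ᵇ_; z≤n; s≤s)
open import Data.Nat.Properties
  using (+-*-semiring; +-identityʳ; +-comm; +-assoc; *-comm; *-identityˡ; *-identityʳ; *-distribˡ-+; *-cancelˡ-≡; +-mono-≤; +-monoˡ-≤;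
         +-cancelˡ-<; +-cancelˡ-≤; ≤-<-trans; ≮⇒≥; _<?_; m+n≡0⇒m≡0; m+n≡0⇒n≡0; suc-injective; ≤ᵇ⇒≤; ≤⇒≤ᵇ;
         m+[n∸m]≡n; <⇒≤; <-irrefl; m≤n+m; m≤m+n; *-cancelʳ-<; m<1+n⇒m<n∨m≡n; <-≤-trans; ≤-trans; ≤-refl; n≤0⇒n≡0; <⇒≱; ≰⇒>; _≤?_)
  renaming (<-cmp to <-cmpℕ; _≟_ to _≟ℕ_)
open import Data.Bool using (Bool; true; false; not; _∧_; _∨_; _xor_; T; if_then_else_)
open import Data.Bool.Properties using (T?; xor-same; ¬-not; not-¬; not-involutive; xor-identityʳ)
import Data.Bool as Bool using (_≟_)
open import Data.Nat.GeneralisedArithmetic using (iterate)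
open import Data.Fin.Permutation using (Permutation′; permutation)
open import Data.Nat.Solver using (module +-*-Solver)
open +-*-Solver using (solve; _:+_; _:*_; _:=_; con)
open import Relation.Binary.Construct.Closure.ReflexiveTransitive using (Star; ε; _◅_)
open import Data.Fin using (Fin; zero; suc; toℕ; _↑ˡ_; _↑ʳ_)
open import Data.Fin.Patterns using (0F; 1F; 2F; 3F; 4F; 5F; 6F; 7F; 8F; 9F)
open import Data.Vec using (Vec; []; _∷_; lookup)
import Data.Vec as V using (tabulate)
open import Data.Vec.Properties using (lookup∘tabulate)
open import Data.Fin.Properties using (_≟_; any?; all?; <-cmp; toℕ-injective; toℕ<n)
open import Data.Fin using () renaming (_<?_ to _<ᶠ?_)
open import Data.List using (List; []; _∷_; length; filter; tabulate; allFin; map; cartesianProductWith)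
open import Data.Bool.ListAction using (any; all)
open import Data.Nat.ListAction using () renaming (sum to sumᴸ)
open import Data.Product using (Σ; ∃; ∃-syntax; _×_; _,_; proj₁; proj₂)
open import Data.Sum using (_⊎_; inj₁; inj₂)
open import Data.List.Relation.Unary.All using (All; []; _∷_)
import Data.List.Relation.Unary.All as All using (lookup; map)
open import Data.List.Relation.Unary.All.Properties using (all⁺; all⁻; map⁺; tabulate⁺)
open import Data.List.Relation.Unary.Any.Properties using (any⁺; any⁻)
open import Data.List.Relation.Unary.Any using (Any; here; there)
open import Data.List.Membership.Propositional using (_∈_; find)
open import Data.List.Membership.Propositional.Properties using (∈-cartesianProductWith⁺)
open import Data.Empty using (⊥; ⊥-elim)
open import Function using (_∘_)
open import Relation.Nullary using (¬_; ¬?; Dec; yes; no; does)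
open import Relation.Nullary.Decidable using (dec-true; dec-false)
open import Relation.Binary.PropositionalEquality
open import Relation.Binary.Definitions using (tri<; tri≈; tri>)
open import Algebra.Properties.Semiring.Sum +-*-semiring
  using (sum; sum-cong-≗; ∑-distrib-+; ∑-comm; ∑-permute; *-distribˡ-sum; sum-replicate-zero)

does⇒ : ∀ {p} {P : Set p} (d : Dec P) → T (does d) → P
does⇒ (yes p) _ = p

T-∧⁻ : ∀ x {y} → T (x ∧ y) → T x × T y
T-∧⁻ true t = _ , t

T-∨⁻ : ∀ x {y} → T (x ∨ y) → T x ⊎ T y
T-∨⁻ true  t = inj₁ t
T-∨⁻ false t = inj₂ t

isOdd : ℕ → Bool
isOdd zero    = false
isOdd (suc j) = not (isOdd j)

not-xor : ∀ x y → not x xor y ≡ x xor not y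
not-xor true  y = sym (not-involutive y)
not-xor false y = refl

xor-true : ∀ x → x xor true ≡ not x
xor-true true  = refl
xor-true false = refl

T⇒≡true : ∀ {b} → T b → b ≡ true
T⇒≡true {true} _ = refl

T-∨ˡ : ∀ x y → T x → T (x ∨ y)
T-∨ˡ true _ _ = _

T-∨ʳ : ∀ x {y} → T y → T (x ∨ y)
T-∨ʳ true  _  = _
T-∨ʳ false ty = ty

T-∧⁺ : ∀ x {y} → T x → T y → T (x ∧ y)
T-∧⁺ true _ ty = ty

xor-cancel : ∀ x y → x xor (x xor y) ≡ y
xor-cancel true  y = not-involutive y
xor-cancel false y = refl

xor-not-cancel : ∀ x y → x xor not (x xor y) ≡ not y
xor-not-cancel true  y = cong not (not-involutive y)
xor-not-cancel false y = refl

T-⇒ : ∀ x {y} → T x → T (not x ∨ y) → T y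
T-⇒ true _ ty = ty

𝟙 : Bool → ℕ
𝟙 true  = 1
𝟙 false = 0

𝟙≤1 : ∀ b → 𝟙 b ≤ 1
𝟙≤1 true  = s≤s z≤n
𝟙≤1 false = z≤n

𝟙-≤-𝟙-not : ∀ a h → (T h → a ≡ false) → 𝟙 a ≤ 𝟙 (not h)
𝟙-≤-𝟙-not a false _        = 𝟙≤1 a
𝟙-≤-𝟙-not a true  h⇒a≡false rewrite h⇒a≡false _ = z≤n

sum-mono-≤ : ∀ {n} {f g : Fin n → ℕ} → (∀ i → f i ≤ g i) → sum f ≤ sum g
sum-mono-≤ {zero}  _   = z≤n
sum-mono-≤ {suc n} f≤g = +-mono-≤ (f≤g zero) (sum-mono-≤ (f≤g ∘ suc))

sum-<⇒∃< : ∀ {n} {f g : Fin n → ℕ} → sum f < sum g → ∃[ i ] f i < g i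
sum-<⇒∃< {zero} ()
sum-<⇒∃< {suc n} {f} {g} Σf<Σg with f zero <? g zero
... | yes f₀<g₀ = zero , f₀<g₀
... | no  f₀≮g₀ with sum-<⇒∃< (+-cancelˡ-< (g zero) _ _ (≤-<-trans (+-monoˡ-≤ _ (≮⇒≥ f₀≮g₀)) Σf<Σg))
...   | i , fi<gi = suc i , fi<gi

sum-≡0⇒≡0 : ∀ {n} {f : Fin n → ℕ} → sum f ≡ 0 → ∀ i → f i ≡ 0
sum-≡0⇒≡0 {suc n} {f} Σf≡0 zero    = m+n≡0⇒m≡0 (f zero) Σf≡0
sum-≡0⇒≡0 {suc n} {f} Σf≡0 (suc i) = sum-≡0⇒≡0 (m+n≡0⇒n≡0 (f zero) Σf≡0) i

sum-const : ∀ n c → sum {n} (λ _ → c) ≡ n * c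
sum-const zero    c = refl
sum-const (suc n) c = cong (c +_) (sum-const n c)

sum-zeros : ∀ {n} {f : Fin n → ℕ} → (∀ i → f i ≡ 0) → sum f ≡ 0
sum-zeros {n} f≡0 = trans (sum-cong-≗ f≡0) (sum-replicate-zero n)

count-tabulate : ∀ {a} {A : Set a} {n} (f : Fin n → A) (p : A → Bool) →
                 length (filter (T? ∘ p) (tabulate f)) ≡ sum (λ i → 𝟙 (p (f i)))
count-tabulate {n = zero}  f p = refl
count-tabulate {n = suc n} f p with p (f zero)
... | true  = cong suc (count-tabulate (f ∘ suc) p)
... | false = count-tabulate (f ∘ suc) p

count≡sum : ∀ {n} (p : Fin n → Bool) → count p ≡ sum (λ i → 𝟙 (p i))
count≡sum p = count-tabulate (λ i → i) p

infix 7 _≟ᵇ_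
_≟ᵇ_ : ∀ {n} → Fin n → Fin n → Bool
i ≟ᵇ j = does (i ≟ j)

sum-δ : ∀ {n} (j : Fin n) (f : Fin n → ℕ) → sum (λ i → 𝟙 (i ≟ᵇ j) * f i) ≡ f j
sum-δ zero    f = trans (cong₂ _+_ (*-identityˡ (f zero)) (sum-zeros {f = λ i → 𝟙 (suc i ≟ᵇ zero) * f (suc i)} (λ _ → refl))) (+-identityʳ (f zero))
sum-δ (suc j) f = sum-δ j (f ∘ suc)

≟ᵇ-sym : ∀ {n} (i j : Fin n) → i ≟ᵇ j ≡ j ≟ᵇ i
≟ᵇ-sym i j with i ≟ j | j ≟ i
... | yes _   | yes _   = refl
... | no  _   | no  _   = refl
... | yes i≡j | no  j≢i = ⊥-elim (j≢i (sym i≡j))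
... | no  i≢j | yes j≡i = ⊥-elim (i≢j (sym j≡i))

𝟙-split : ∀ b x → x ≡ 𝟙 b * x + 𝟙 (not b) * x
𝟙-split true  x = sym (trans (+-identityʳ (x + 0)) (+-identityʳ x))
𝟙-split false x = sym (+-identityʳ x)

module Frame {m n : ℕ} (φ : Fin m → Fin n) (φ-injective : ∀ {k l} → φ k ≡ φ l → k ≡ l) where

  Inside : Fin n → Set
  Inside u = ∃[ k ] φ k ≡ u

  opaque
    inside? : (u : Fin n) → Dec (Inside u)
    inside? u = any? (λ k → φ k ≟ u)

  outside : Fin n → Bool
  outside u = not (does (inside? u))

  φ-≟ᵇ : ∀ k l → φ k ≟ᵇ φ l ≡ k ≟ᵇ l
  φ-≟ᵇ k l with φ k ≟ φ l | k ≟ l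
  ... | yes _       | yes _   = refl
  ... | no  _       | no  _   = refl
  ... | yes φk≡φl   | no  k≢l = ⊥-elim (k≢l (φ-injective φk≡φl))
  ... | no  φk≢φl   | yes k≡l = ⊥-elim (φk≢φl (cong φ k≡l))

  private
    inside-δ : (g : Fin n → ℕ) (u : Fin n) → 𝟙 (does (inside? u)) * g u ≡ sum (λ k → 𝟙 (u ≟ᵇ φ k) * g u)
    inside-δ g u with inside? u
    ... | yes (k , refl) = trans (*-identityˡ (g (φ k))) (sym (trans (sum-cong-≗ (λ l → cong (λ b → 𝟙 b * g (φ k)) (trans (φ-≟ᵇ k l) (≟ᵇ-sym k l))))
                                      (sum-δ k (λ _ → g (φ k)))))
    ... | no  u∉φ        = sym (sum-zeros (λ k → cong (λ b → 𝟙 b * g u) (dec-false (u ≟ φ k) (λ u≡φk → u∉φ (k , sym u≡φk)))))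

  sum-frame : (g : Fin n → ℕ) → sum g ≡ sum (g ∘ φ) + sum (λ u → 𝟙 (outside u) * g u)
  sum-frame g = begin
    sum g                                                           ≡⟨ sum-cong-≗ (λ u → 𝟙-split (does (inside? u)) (g u)) ⟩
    sum (λ u → 𝟙 (does (inside? u)) * g u + 𝟙 (outside u) * g u)     ≡⟨ ∑-distrib-+ (λ u → 𝟙 (does (inside? u)) * g u) (λ u → 𝟙 (outside u) * g u) ⟩
    sum (λ u → 𝟙 (does (inside? u)) * g u) + sum (λ u → 𝟙 (outside u) * g u)
      ≡⟨ cong (_+ sum (λ u → 𝟙 (outside u) * g u)) inside-sum ⟩
    sum (g ∘ φ) + sum (λ u → 𝟙 (outside u) * g u)                    ∎
    where
    open ≡-Reasoning
    inside-sum : sum (λ u → 𝟙 (does (inside? u)) * g u) ≡ sum (g ∘ φ)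
    inside-sum = begin
      sum (λ u → 𝟙 (does (inside? u)) * g u)        ≡⟨ sum-cong-≗ (inside-δ g) ⟩
      sum (λ u → sum (λ k → 𝟙 (u ≟ᵇ φ k) * g u))    ≡⟨ ∑-comm (λ u k → 𝟙 (u ≟ᵇ φ k) * g u) ⟩
      sum (λ k → sum (λ u → 𝟙 (u ≟ᵇ φ k) * g u))    ≡⟨ sum-cong-≗ (λ k → sum-δ (φ k) g) ⟩
      sum (g ∘ φ)                                   ∎

  sum-frame-≥ : (g : Fin n → ℕ) → sum (g ∘ φ) ≤ sum g
  sum-frame-≥ g = subst (sum (g ∘ φ) ≤_) (sym (sum-frame g)) (m≤m+n _ _)

  outside⇒∉ : ∀ {u} → outside u ≡ true → ¬ Inside u
  outside⇒∉ {u} out u∈φ with inside? u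
  outside⇒∉ () u∈φ | yes _
  ... | no u∉φ = u∉φ u∈φ

sum-𝟙≟ : ∀ {n} (j : Fin n) → sum (λ i → 𝟙 (i ≟ᵇ j)) ≡ 1
sum-𝟙≟ j = trans (sum-cong-≗ (λ i → sym (*-identityʳ (𝟙 (i ≟ᵇ j))))) (sum-δ j (λ _ → 1))

sum-𝟙≡1⇒unique : ∀ {n} (p : Fin n → Bool) → sum (λ i → 𝟙 (p i)) ≡ 1 →
                 Σ (Fin n) λ z → p z ≡ true × (∀ w → p w ≡ true → w ≡ z)
sum-𝟙≡1⇒unique {suc n} p Σ≡1 with p zero in p₀
... | true  = zero , p₀ , unique
  where
  unique : ∀ w → p w ≡ true → w ≡ zero
  unique zero    _  = refl
  unique (suc w) pw with () ← trans (cong 𝟙 (sym pw)) (sum-≡0⇒≡0 (suc-injective Σ≡1) w)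
... | false with sum-𝟙≡1⇒unique (p ∘ suc) Σ≡1
...   | z , pz , unique = suc z , pz , λ { zero pw → ⊥-elim (true≢false (trans (sym pw) p₀))
                                          ; (suc w) pw → cong suc (unique w pw) }
  where
  true≢false : true ≢ false
  true≢false ()

sum-allFin : ∀ n (f : Fin n → ℕ) → sumᴸ (map f (allFin n)) ≡ sum f
sum-allFin n f = go (λ i → i)
  where
  go : ∀ {k} (g : Fin k → Fin n) → sumᴸ (map f (tabulate g)) ≡ sum (f ∘ g)
  go {zero}  g = refl
  go {suc k} g = cong (f (g zero) +_) (go (g ∘ suc))

-- Each unordered pair {u, v} is counted once by countPairs and twice in the sum of the row counts.
countPairs-double : ∀ {n} (r : Fin n → Fin n → Bool) → (∀ u v → r u v ≡ r v u) → (∀ u → r u u ≡ false) →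
                    2 * countPairs r ≡ sum (λ u → count (r u))
countPairs-double {n} r r-sym r-irrefl = begin
  2 * countPairs r                                       ≡⟨ cong (2 *_) (trans (sum-allFin n (λ u → count (λ v → does (u <ᶠ? v) ∧ r u v))) (sum-cong-≗ (λ u → count≡sum (λ v → does (u <ᶠ? v) ∧ r u v)))) ⟩
  2 * sum (λ u → sum (λ v → ordered u v))                ≡⟨ cong (sum (λ u → sum (λ v → ordered u v)) +_) (trans (+-identityʳ _) (∑-comm ordered)) ⟩
  sum (λ u → sum (λ v → ordered u v)) + sum (λ u → sum (λ v → ordered v u))
    ≡⟨ sym (∑-distrib-+ (λ u → sum (λ v → ordered u v)) (λ u → sum (λ v → ordered v u))) ⟩
  sum (λ u → sum (λ v → ordered u v) + sum (λ v → ordered v u))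
    ≡⟨ sum-cong-≗ (λ u → sym (∑-distrib-+ (λ v → ordered u v) (λ v → ordered v u))) ⟩
  sum (λ u → sum (λ v → ordered u v + ordered v u))      ≡⟨ sum-cong-≗ (λ u → sum-cong-≗ (λ v → sym (unordered u v))) ⟩
  sum (λ u → sum (λ v → 𝟙 (r u v)))                      ≡⟨ sum-cong-≗ (λ u → sym (count≡sum (r u))) ⟩
  sum (λ u → count (r u))                                ∎
  where
  open ≡-Reasoning
  ordered : Fin n → Fin n → ℕ
  ordered u v = 𝟙 (does (u <ᶠ? v) ∧ r u v)
  unordered : ∀ u v → 𝟙 (r u v) ≡ ordered u v + ordered v u
  unordered u v with <-cmp u v
  ... | tri< u<v _ v≮u rewrite dec-true (u <ᶠ? v) u<v | dec-false (v <ᶠ? u) v≮u = sym (+-identityʳ _)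
  ... | tri> u≮v _ v<u rewrite dec-false (u <ᶠ? v) u≮v | dec-true (v <ᶠ? u) v<u = cong 𝟙 (r-sym u v)
  ... | tri≈ u≮u refl _ rewrite dec-false (u <ᶠ? u) u≮u | r-irrefl u = refl

hamming : ∀ {n} → (Fin n → Fin n) → (Fin n → Fin n) → ℕ
hamming f g = sum (λ u → 𝟙 (not (f u ≟ᵇ g u)))

hamming-self : ∀ {n} (f : Fin n → Fin n) → hamming f f ≡ 0
hamming-self f = sum-zeros (λ u → cong (λ b → 𝟙 (not b)) (dec-true (f u ≟ f u) refl))

sum-𝟙-xor : ∀ {n} (a b : Fin n) → sum (λ v → 𝟙 ((v ≟ᵇ a) xor (v ≟ᵇ b))) ≡ 2 * 𝟙 (not (a ≟ᵇ b))
sum-𝟙-xor a b with a ≟ b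
... | yes refl = sum-zeros (λ v → cong 𝟙 (xor-same (v ≟ᵇ a)))
... | no  a≢b  = begin
  sum (λ v → 𝟙 ((v ≟ᵇ a) xor (v ≟ᵇ b)))           ≡⟨ sum-cong-≗ 𝟙-xor ⟩
  sum (λ v → 𝟙 (v ≟ᵇ a) + 𝟙 (v ≟ᵇ b))             ≡⟨ ∑-distrib-+ (λ v → 𝟙 (v ≟ᵇ a)) (λ v → 𝟙 (v ≟ᵇ b)) ⟩
  sum (λ v → 𝟙 (v ≟ᵇ a)) + sum (λ v → 𝟙 (v ≟ᵇ b)) ≡⟨ cong₂ _+_ (sum-𝟙≟ a) (sum-𝟙≟ b) ⟩
  2                                               ∎
  where
  open ≡-Reasoning
  𝟙-xor : ∀ v → 𝟙 ((v ≟ᵇ a) xor (v ≟ᵇ b)) ≡ 𝟙 (v ≟ᵇ a) + 𝟙 (v ≟ᵇ b)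
  𝟙-xor v with v ≟ a | v ≟ b
  ... | yes refl | yes refl = ⊥-elim (a≢b refl)
  ... | yes _    | no  _    = refl
  ... | no  _    | yes _    = refl
  ... | no  _    | no  _    = refl

module _ {n : ℕ} {G : Graph n} where

  adj⇒≢ : ∀ {u v} → adj G u v ≡ true → u ≢ v
  adj⇒≢ {u} uv refl with () ← trans (sym uv) (irrefl G u)

  -- Opaque, so that partners of variable matchings never get unfolded during conversion checking.
  opaque
    unique-partner : (M : PerfectMatching G) (u : Fin n) →
                     Σ (Fin n) λ v → edge M u v ≡ true × (∀ w → edge M u w ≡ true → w ≡ v)
    unique-partner M u = sum-𝟙≡1⇒unique (edge M u) (trans (sym (count≡sum (edge M u))) (perfect M u))

    partner : PerfectMatching G → Fin n → Fin n
    partner M u = proj₁ (unique-partner M u)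

    partner-edge : (M : PerfectMatching G) (u : Fin n) → edge M u (partner M u) ≡ true
    partner-edge M u = proj₁ (proj₂ (unique-partner M u))

    partner-unique : (M : PerfectMatching G) {u v : Fin n} → edge M u v ≡ true → v ≡ partner M u
    partner-unique M {u} {v} = proj₂ (proj₂ (unique-partner M u)) v

  edge≡partner : (M : PerfectMatching G) (u v : Fin n) → edge M u v ≡ v ≟ᵇ partner M u
  edge≡partner M u v with v ≟ partner M u
  ... | yes refl = partner-edge M u
  ... | no  v≢pu with edge M u v in uv
  ...   | false = refl
  ...   | true  = ⊥-elim (v≢pu (partner-unique M uv))

  partner-involutive : (M : PerfectMatching G) (u : Fin n) → partner M (partner M u) ≡ u
  partner-involutive M u =
    sym (partner-unique M (trans (edge-sym M (partner M u) u) (partner-edge M u)))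

  partner-adj : (M : PerfectMatching G) (u : Fin n) → adj G u (partner M u) ≡ true
  partner-adj M u = edge-adj M u (partner M u) (partner-edge M u)

  partner-≢ : (M : PerfectMatching G) (u : Fin n) → partner M u ≢ u
  partner-≢ M u pu≡u = adj⇒≢ (partner-adj M u) (sym pu≡u)

  symDiff≡hamming : (M N : PerfectMatching G) → symDiff M N ≡ hamming (partner M) (partner N)
  symDiff≡hamming M N = *-cancelˡ-≡ _ _ 2 (begin
    2 * symDiff M N                                             ≡⟨ countPairs-double r r-sym r-irrefl ⟩
    sum (λ u → count (r u))                                     ≡⟨ sum-cong-≗ row ⟩
    sum (λ u → 2 * 𝟙 (not (partner M u ≟ᵇ partner N u)))         ≡⟨ sym (*-distribˡ-sum 2 (λ u → 𝟙 (not (partner M u ≟ᵇ partner N u)))) ⟩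
    2 * hamming (partner M) (partner N)                         ∎)
    where
    open ≡-Reasoning
    r : Fin n → Fin n → Bool
    r u v = edge M u v xor edge N u v
    r-sym : ∀ u v → r u v ≡ r v u
    r-sym u v = cong₂ _xor_ (edge-sym M u v) (edge-sym N u v)
    edge-irrefl : (K : PerfectMatching G) (u : Fin n) → edge K u u ≡ false
    edge-irrefl K u with edge K u u in uu
    ... | false = refl
    ... | true  = ⊥-elim (adj⇒≢ (edge-adj K u u uu) refl)
    r-irrefl : ∀ u → r u u ≡ false
    r-irrefl u = cong₂ _xor_ (edge-irrefl M u) (edge-irrefl N u)
    row : ∀ u → count (r u) ≡ 2 * 𝟙 (not (partner M u ≟ᵇ partner N u))
    row u = trans (count≡sum (r u))
      (trans (sum-cong-≗ (λ v → cong 𝟙 (cong₂ _xor_ (edge≡partner M u v) (edge≡partner N u v))))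
             (sum-𝟙-xor (partner M u) (partner N u)))

  fromInvolution : (r : Fin n → Fin n) → (∀ u → r (r u) ≡ u) → (∀ u → adj G u (r u) ≡ true) → PerfectMatching G
  fromInvolution r r-involutive r-adj = record
    { edge     = λ u v → v ≟ᵇ r u
    ; edge-sym = symmetric
    ; edge-adj = adjacent
    ; perfect  = λ u → trans (count≡sum (λ v → v ≟ᵇ r u)) (sum-𝟙≟ (r u))
    }
    where
    symmetric : ∀ u v → v ≟ᵇ r u ≡ u ≟ᵇ r v
    symmetric u v with v ≟ r u | u ≟ r v
    ... | yes _    | yes _    = refl
    ... | no  _    | no  _    = refl
    ... | yes refl | no  u≢rv = ⊥-elim (u≢rv (sym (r-involutive u)))
    ... | no  v≢ru | yes refl = ⊥-elim (v≢ru (sym (r-involutive v)))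
    adjacent : ∀ u v → v ≟ᵇ r u ≡ true → adj G u v ≡ true
    adjacent u v _ with v ≟ r u
    ... | yes refl = r-adj u

  partner-fromInvolution : (r : Fin n → Fin n) (r-involutive : ∀ u → r (r u) ≡ u) (r-adj : ∀ u → adj G u (r u) ≡ true) →
                           ∀ u → partner (fromInvolution r r-involutive r-adj) u ≡ r u
  partner-fromInvolution r r-involutive r-adj u =
    sym (partner-unique (fromInvolution r r-involutive r-adj) (dec-true (r u ≟ r u) refl))

-- Frames: a matching agreeing with a local involution σ on an injective frame φ : Fin m → Fin n.
module _ {n : ℕ} {G : Graph n} {m : ℕ} (φ : Fin m → Fin n) where

  record Represents (N : PerfectMatching G) (σ : Fin m → Fin m) : Set where
    constructor represents
    field on-frame : ∀ k → partner N (φ k) ≡ φ (σ k)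

open Represents public

isLocalSwitch : ∀ {m} → (Fin m → Fin m → Bool) → (Fin m → Fin m) → (Fin m → Fin m) → Bool
isLocalSwitch A σ σ′ = (hamming σ σ′ ≤ᵇ 6) ∧ does (all? (λ k → T? ((σ′ (σ′ k) ≟ᵇ k) ∧ A k (σ′ k))))

LocalSwitch : ∀ {m} → (Fin m → Fin m → Bool) → (Fin m → Fin m) → (Fin m → Fin m) → Set
LocalSwitch A σ σ′ = T (isLocalSwitch A σ σ′)

isLocalPath : ∀ {m} → (Fin m → Fin m → Bool) → (Fin m → Fin m) → List (Fin m → Fin m) → (Fin m → Fin m) → Bool
isLocalPath A s []       t = isLocalSwitch A s t
isLocalPath A s (σ ∷ σs) t = isLocalSwitch A s σ ∧ isLocalPath A σ σs t

isLocalPath-sound : ∀ {m} (A : Fin m → Fin m → Bool) s σs t → T (isLocalPath A s σs t) → Star (LocalSwitch A) s t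
isLocalPath-sound A s []       t ok = ok ◅ ε
isLocalPath-sound A s (σ ∷ σs) t ok = proj₁ split ◅ isLocalPath-sound A σ σs t (proj₂ split)
  where
  split = T-∧⁻ (isLocalSwitch A s σ) ok

joins : ∀ {m} → Fin m × Fin m → Fin m → Fin m → Bool
joins (i , j) k l = (k ≟ᵇ i ∧ l ≟ᵇ j) ∨ (k ≟ᵇ j ∧ l ≟ᵇ i)

localGraph : ∀ {m} → (Fin m → Fin m) → (Fin m → Fin m) → List (Fin m × Fin m) → Fin m → Fin m → Bool
localGraph s t es k l = (l ≟ᵇ s k) ∨ (l ≟ᵇ t k) ∨ any (λ e → joins e k l) es

record Certificate (m : ℕ) : Set where
  constructor certificate
  field
    extra-edges : List (Fin m × Fin m)
    steps       : List (Fin m → Fin m)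

open Certificate public

isValid : ∀ {m} → (Fin m → Fin m) → (Fin m → Fin m) → Certificate m → Bool
isValid s t c = isLocalPath (localGraph s t (extra-edges c)) s (steps c) t

Valid : ∀ {m} → (Fin m → Fin m) → (Fin m → Fin m) → Certificate m → Set
Valid s t c = T (isValid s t c)

module Framed {n : ℕ} {G : Graph n} {m : ℕ} (φ : Fin m → Fin n) (φ-injective : ∀ {k l} → φ k ≡ φ l → k ≡ l) where

  open Frame φ φ-injective public

  outsideHamming : (Fin n → Fin n) → (Fin n → Fin n) → ℕ
  outsideHamming f g = sum (λ u → 𝟙 (outside u) * 𝟙 (not (f u ≟ᵇ g u)))

  hamming-frame : {N N′ : PerfectMatching G} {σ σ′ : Fin m → Fin m} → Represents φ N σ → Represents φ N′ σ′ →
                  hamming (partner N) (partner N′) ≡ hamming σ σ′ + outsideHamming (partner N) (partner N′)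
  hamming-frame {N} {N′} {σ} {σ′} N∼σ N′∼σ′ = trans (sum-frame _) (cong (_+ outsideHamming (partner N) (partner N′))
    (sum-cong-≗ (λ k → cong (λ b → 𝟙 (not b)) (trans (cong₂ _≟ᵇ_ (on-frame N∼σ k) (on-frame N′∼σ′ k)) (φ-≟ᵇ (σ k) (σ′ k))))))

  outsideHamming-agree : {f g : Fin n → Fin n} → (∀ u → ¬ Inside u → f u ≡ g u) → outsideHamming f g ≡ 0
  outsideHamming-agree {f} {g} agree = sum-zeros pointwise
    where
    pointwise : ∀ u → 𝟙 (outside u) * 𝟙 (not (f u ≟ᵇ g u)) ≡ 0
    pointwise u with inside? u
    ... | yes _   = refl
    ... | no  u∉φ rewrite agree u u∉φ | dec-true (g u ≟ g u) refl = refl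

  outsideHamming≡0⇒agree : {f g : Fin n → Fin n} → outsideHamming f g ≡ 0 → ∀ u → ¬ Inside u → f u ≡ g u
  outsideHamming≡0⇒agree {f} {g} out≡0 u u∉φ with inside? u | sum-≡0⇒≡0 out≡0 u
  ... | yes u∈φ | _    = ⊥-elim (u∉φ u∈φ)
  ... | no  _   | u≡0  with f u ≟ g u
  ...   | yes fu≡gu = fu≡gu

  represented-involutive : {N : PerfectMatching G} {σ : Fin m → Fin m} → Represents φ N σ → ∀ k → σ (σ k) ≡ k
  represented-involutive {N} {σ} N∼σ k =
    φ-injective (trans (sym (on-frame N∼σ (σ k))) (trans (cong (partner N) (sym (on-frame N∼σ k))) (partner-involutive N (φ k))))

  represented-adj : {N : PerfectMatching G} {σ : Fin m → Fin m} → Represents φ N σ → ∀ k → adj G (φ k) (φ (σ k)) ≡ true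
  represented-adj {N} N∼σ k = trans (cong (adj G (φ k)) (sym (on-frame N∼σ k))) (partner-adj N (φ k))

  module Glue (M : PerfectMatching G) {s : Fin m → Fin m} (M∼s : Represents φ M s)
              (σ : Fin m → Fin m) (σ-involutive : ∀ k → σ (σ k) ≡ k) (σ-adj : ∀ k → adj G (φ k) (φ (σ k)) ≡ true) where

    private
      glueWith : (u : Fin n) → Dec (Inside u) → Fin n
      glueWith u (yes (k , _)) = φ (σ k)
      glueWith u (no _)        = partner M u

    glue : Fin n → Fin n
    glue u = glueWith u (inside? u)

    glue-inside : ∀ k → glue (φ k) ≡ φ (σ k)
    glue-inside k with inside? (φ k)
    ... | yes (l , φl≡φk) = cong (φ ∘ σ) (φ-injective φl≡φk)
    ... | no  φk∉φ        = ⊥-elim (φk∉φ (k , refl))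

    glue-outside : ∀ u → ¬ Inside u → glue u ≡ partner M u
    glue-outside u u∉φ with inside? u
    ... | yes u∈φ = ⊥-elim (u∉φ u∈φ)
    ... | no  _   = refl

    partner-outside : ∀ u → ¬ Inside u → ¬ Inside (partner M u)
    partner-outside u u∉φ (k , φk≡pu) =
      u∉φ (s k , trans (sym (on-frame M∼s k)) (trans (cong (partner M) φk≡pu) (partner-involutive M u)))

    glue-involutive : ∀ u → glue (glue u) ≡ u
    glue-involutive u with inside? u
    ... | yes (k , refl) = trans (glue-inside (σ k)) (cong φ (σ-involutive k))
    ... | no  u∉φ        = trans (glue-outside (partner M u) (partner-outside u u∉φ)) (partner-involutive M u)

    glue-adj : ∀ u → adj G u (glue u) ≡ true
    glue-adj u with inside? u
    ... | yes (k , refl) = σ-adj k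
    ... | no  _          = partner-adj M u

    glued : PerfectMatching G
    glued = fromInvolution glue glue-involutive glue-adj

    glued∼σ : Represents φ glued σ
    glued∼σ = represents λ k → trans (partner-fromInvolution {G = G} glue glue-involutive glue-adj (φ k)) (glue-inside k)

    glued-outside : ∀ u → ¬ Inside u → partner glued u ≡ partner M u
    glued-outside u u∉φ = trans (partner-fromInvolution {G = G} glue glue-involutive glue-adj u) (glue-outside u u∉φ)

  switch-framed : {N N′ : PerfectMatching G} {σ σ′ : Fin m → Fin m} → Represents φ N σ → Represents φ N′ σ′ →
                  hamming σ σ′ + outsideHamming (partner N) (partner N′) ≤ 6 → Switch3 N N′
  switch-framed {N} {N′} N∼σ N′∼σ′ =
    subst (_≤ 6) (sym (trans (symDiff≡hamming {G = G} N N′) (hamming-frame N∼σ N′∼σ′)))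

  switch-framed-agree : {N N′ : PerfectMatching G} {σ σ′ : Fin m → Fin m} → Represents φ N σ → Represents φ N′ σ′ →
                        (∀ u → ¬ Inside u → partner N u ≡ partner N′ u) → hamming σ σ′ ≤ 6 → Switch3 N N′
  switch-framed-agree {σ = σ} {σ′} N∼σ N′∼σ′ agree σσ′≤6 = switch-framed N∼σ N′∼σ′
    (subst (_≤ 6) (sym (trans (cong (hamming σ σ′ +_) (outsideHamming-agree agree)) (+-identityʳ _))) σσ′≤6)

  module Lift (M M′ : PerfectMatching G) {s t : Fin m → Fin m} (M∼s : Represents φ M s) (M′∼t : Represents φ M′ t)
              (agree : ∀ u → ¬ Inside u → partner M u ≡ partner M′ u)
              (A : Fin m → Fin m → Bool) (A-adj : ∀ k l → T (A k l) → adj G (φ k) (φ l) ≡ true) where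

    lift-from : ∀ {σ} (N : PerfectMatching G) → Represents φ N σ → (∀ u → ¬ Inside u → partner N u ≡ partner M u) →
                Star (LocalSwitch A) σ t → Star Switch3 N M′
    lift-from {σ} N N∼σ N-outside ε =
      switch-framed-agree N∼σ M′∼t (λ u u∉φ → trans (N-outside u u∉φ) (agree u u∉φ))
                          (subst (_≤ 6) (sym (hamming-self σ)) z≤n) ◅ ε
    lift-from {σ} N N∼σ N-outside (_◅_ {j = σ′} σσ′ path) =
      switch-framed-agree N∼σ glued∼σ (λ u u∉φ → trans (N-outside u u∉φ) (sym (glued-outside u u∉φ)))
                          (≤ᵇ⇒≤ _ 6 (proj₁ (T-∧⁻ (hamming σ σ′ ≤ᵇ 6) σσ′))) ◅ lift-from glued glued∼σ glued-outside path
      where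
      σ′-ok : ∀ k → T ((σ′ (σ′ k) ≟ᵇ k) ∧ A k (σ′ k))
      σ′-ok = does⇒ (all? _) (proj₂ (T-∧⁻ (hamming σ σ′ ≤ᵇ 6) σσ′))
      open Glue M M∼s σ′ (λ k → does⇒ (σ′ (σ′ k) ≟ k) (proj₁ (T-∧⁻ (σ′ (σ′ k) ≟ᵇ k) (σ′-ok k))))
                         (λ k → A-adj k (σ′ k) (proj₂ (T-∧⁻ (σ′ (σ′ k) ≟ᵇ k) (σ′-ok k))))

    lift : Star (LocalSwitch A) s t → Star Switch3 M M′
    lift = lift-from M M∼s (λ _ _ → refl)

  outsideHamming-congˡ : {f f′ : Fin n → Fin n} (g : Fin n → Fin n) → (∀ u → ¬ Inside u → f u ≡ f′ u) →
                         outsideHamming f g ≡ outsideHamming f′ g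
  outsideHamming-congˡ {f} {f′} g agree = sum-cong-≗ pointwise
    where
    pointwise : ∀ u → 𝟙 (outside u) * 𝟙 (not (f u ≟ᵇ g u)) ≡ 𝟙 (outside u) * 𝟙 (not (f′ u ≟ᵇ g u))
    pointwise u with inside? u
    ... | yes _   = refl
    ... | no  u∉φ = cong (λ v → 𝟙 (not (v ≟ᵇ g u)) + 0) (agree u u∉φ)

  -- Switching M to M′ inside the frame first leaves exactly the disagreements outside the frame.
  switch-frame-then-outside : (M M′ : PerfectMatching G) {s t : Fin m → Fin m} → Represents φ M s → Represents φ M′ t →
                              hamming s t ≤ 6 → hamming (partner M) (partner M′) ≤ hamming s t + 6 → Star Switch3 M M′
  switch-frame-then-outside M M′ {s} {t} M∼s M′∼t st≤6 MM′≤ = _◅_ {j = glued} inside (outside-step ◅ ε)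
    where
    open Glue M M∼s t (represented-involutive M′∼t) (represented-adj M′∼t)
    inside : Switch3 M glued
    inside = switch-framed-agree M∼s glued∼σ (λ u u∉φ → sym (glued-outside u u∉φ)) st≤6
    rest≤6 : hamming t t + outsideHamming (partner glued) (partner M′) ≤ 6
    rest≤6 = subst (_≤ 6) (sym (cong₂ _+_ (hamming-self t) (outsideHamming-congˡ (partner M′) glued-outside)))
               (+-cancelˡ-≤ (hamming s t) _ _ (subst (_≤ hamming s t + 6) (hamming-frame M∼s M′∼t) MM′≤))
    outside-step : Switch3 glued M′
    outside-step = switch-framed glued∼σ M′∼t rest≤6

  Edges : List (Fin m × Fin m) → Set
  Edges = All (λ e → adj G (φ (proj₁ e)) (φ (proj₂ e)) ≡ true)

  joins-sound : ∀ e {k l} → adj G (φ (proj₁ e)) (φ (proj₂ e)) ≡ true → T (joins e k l) → adj G (φ k) (φ l) ≡ true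
  joins-sound (i , j) {k} {l} ij kl with T-∨⁻ (k ≟ᵇ i ∧ l ≟ᵇ j) kl
  ... | inj₁ same with T-∧⁻ (k ≟ᵇ i) same
  ...   | k≟i , l≟j with does⇒ (k ≟ i) k≟i | does⇒ (l ≟ j) l≟j
  ...     | refl | refl = ij
  joins-sound (i , j) {k} {l} ij kl | inj₂ swapped with T-∧⁻ (k ≟ᵇ j) swapped
  ...   | k≟j , l≟i with does⇒ (k ≟ j) k≟j | does⇒ (l ≟ i) l≟i
  ...     | refl | refl = trans (adj-sym G (φ j) (φ i)) ij

  localGraph-sound : {M M′ : PerfectMatching G} {s t : Fin m → Fin m} {es : List (Fin m × Fin m)} →
                     Represents φ M s → Represents φ M′ t → Edges es →
                     ∀ k l → T (localGraph s t es k l) → adj G (φ k) (φ l) ≡ true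
  localGraph-sound {s = s} {t} M∼s M′∼t es-edges k l kl with l ≟ s k
  ... | yes refl = represented-adj M∼s k
  ... | no  _ with l ≟ t k
  ...   | yes refl = represented-adj M′∼t k
  ...   | no  _    = extra es-edges kl
    where
    extra : ∀ {es} → Edges es → T (any (λ e → joins e k l) es) → adj G (φ k) (φ l) ≡ true
    extra {e ∷ _} (e-edge ∷ es-edges) kl with T-∨⁻ (joins e k l) kl
    ... | inj₁ joined = joins-sound e e-edge joined
    ... | inj₂ later  = extra es-edges later

  switch-by-certificate : (M M′ : PerfectMatching G) {s t : Fin m → Fin m} → Represents φ M s → Represents φ M′ t →
                          (∀ u → ¬ Inside u → partner M u ≡ partner M′ u) →
                          (c : Certificate m) → Valid s t c → Edges (extra-edges c) → Star Switch3 M M′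
  switch-by-certificate M M′ {s} {t} M∼s M′∼t agree c valid es-edges =
    Lift.lift M M′ M∼s M′∼t agree A (localGraph-sound M∼s M′∼t es-edges) (isLocalPath-sound A s (steps c) t valid)
    where
    A : Fin m → Fin m → Bool
    A = localGraph s t (extra-edges c)

even-or-odd : ∀ δ → ∃[ d ] (δ ≡ d * 2 ⊎ δ ≡ suc (d * 2))
even-or-odd zero = 0 , inj₁ refl
even-or-odd (suc δ) with even-or-odd δ
... | d , inj₁ refl = d , inj₂ refl
... | d , inj₂ refl = suc d , inj₁ refl

record FreeInvolution {a} {A : Set a} (f : A → A) : Set a where
  field
    involutive       : ∀ x → f (f x) ≡ x
    fixed-point-free : ∀ x → f x ≢ x

  injective : ∀ {x y} → f x ≡ f y → x ≡ y
  injective {x} {y} fx≡fy = trans (sym (involutive x)) (trans (cong f fx≡fy) (involutive y))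

open FreeInvolution

alternate : ∀ {a} {A : Set a} → (A → A) → (A → A) → A → ℕ → A
alternate f g x zero    = x
alternate f g x (suc i) = alternate g f (f x) i

module _ {a} {A : Set a} where

  alternate-even-step : ∀ (f g : A → A) x d → alternate f g x (suc (d * 2)) ≡ f (alternate f g x (d * 2))
  alternate-even-step f g x zero    = refl
  alternate-even-step f g x (suc d) = alternate-even-step f g (g (f x)) d

  -- Folding an odd closed walk in the middle would produce a fixed point of f or g.
  alternate-no-odd-return : ∀ {f g : A → A} → FreeInvolution f → FreeInvolution g →
                            ∀ x d → alternate f g x (suc (d * 2)) ≢ x
  alternate-no-odd-return {f} F G x zero    = fixed-point-free F x
  alternate-no-odd-return {f} {g} F G x (suc d) returns = alternate-no-odd-return G F (f x) d
    (trans (sym (involutive F _)) (cong f (trans (sym (alternate-even-step f g x (suc d))) returns)))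

  alternate-odd-gap : ∀ {f g : A → A} → FreeInvolution f → FreeInvolution g →
                      ∀ x i d → alternate f g x i ≢ alternate f g x (i + suc (d * 2))
  alternate-odd-gap F G x zero    d eq = alternate-no-odd-return F G x d (sym eq)
  alternate-odd-gap {f} F G x (suc i) d eq = alternate-odd-gap G F (f x) i d eq

  alternate-even-gap : ∀ {f g : A → A} → FreeInvolution f → FreeInvolution g →
                       ∀ x i d → alternate f g x i ≡ alternate f g x (i + d * 2) → alternate f g x (d * 2) ≡ x
  alternate-even-gap F G x zero    d eq = sym eq
  alternate-even-gap {f} {g} F G x (suc i) d eq =
    injective F (trans (sym (alternate-even-step f g x d)) (alternate-even-gap G F (f x) i d eq))

  alternate-mismatch : ∀ {f g : A → A} → FreeInvolution f → FreeInvolution g →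
                       ∀ {x} → f x ≢ g x → ∀ i → f (alternate f g x i) ≢ g (alternate f g x i)
  alternate-mismatch F G fx≢gx zero = fx≢gx
  alternate-mismatch {f} {g} F G {x} fx≢gx (suc i) =
    λ eq → alternate-mismatch G F (λ gfx≡ffx → fx≢gx (trans (sym (involutive G (f x))) (cong g (trans gfx≡ffx (involutive F x))))) i (sym eq)

  -- Two visits of the same point are an even number of steps apart, and then the walk already returned to x.
  alternate-distinct : ∀ {f g : A → A} → FreeInvolution f → FreeInvolution g → ∀ x c →
                       (∀ d → 0 < d → d < c → alternate f g x (d * 2) ≢ x) →
                       ∀ {i j} → i < j → j < c * 2 → alternate f g x i ≢ alternate f g x j
  alternate-distinct {f} {g} F G x c no-return {i} {j} i<j j<2c eq with j ∸ i | m+[n∸m]≡n (<⇒≤ i<j)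
  ... | δ | i+δ≡j with even-or-odd δ
  ...   | d     , inj₂ refl = alternate-odd-gap F G x i d (trans eq (cong (alternate f g x) (sym i+δ≡j)))
  ...   | zero  , inj₁ refl = <-irrefl (trans (sym (+-identityʳ i)) i+δ≡j) i<j
  ...   | suc d , inj₁ refl =
    no-return (suc d) (s≤s z≤n) (*-cancelʳ-< 2 (suc d) c (≤-<-trans (subst (suc d * 2 ≤_) i+δ≡j (m≤n+m _ i)) j<2c))
      (alternate-even-gap F G x i (suc d) (trans eq (cong (alternate f g x) (sym i+δ≡j))))

  alternate-injective : ∀ {f g : A → A} → FreeInvolution f → FreeInvolution g → ∀ x c →
                        (∀ d → 0 < d → d < c → alternate f g x (d * 2) ≢ x) →
                        ∀ {i j} → i < c * 2 → j < c * 2 → alternate f g x i ≡ alternate f g x j → i ≡ j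
  alternate-injective F G x c no-return {i} {j} i<2c j<2c eq with <-cmpℕ i j
  ... | tri≈ _ i≡j _ = i≡j
  ... | tri< i<j _ _ = ⊥-elim (alternate-distinct F G x c no-return i<j j<2c eq)
  ... | tri> _ _ j<i = ⊥-elim (alternate-distinct F G x c no-return j<i i<2c (sym eq))

≤-eval : ∀ {m n} {m≤ᵇn : T (m ≤ᵇ n)} → m ≤ n
≤-eval {m} {n} {m≤ᵇn} = ≤ᵇ⇒≤ m n m≤ᵇn

-- The matchings M = {01, 23, …} and M′ = {12, 34, …, (ℓ-1)0} of an alternating cycle 0, 1, …, ℓ-1.
σ₄ τ₄ : Fin 4 → Fin 4
σ₄ = lookup (1F ∷ 0F ∷ 3F ∷ 2F ∷ [])
τ₄ = lookup (3F ∷ 2F ∷ 1F ∷ 0F ∷ [])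

σ₆ τ₆ : Fin 6 → Fin 6
σ₆ = lookup (1F ∷ 0F ∷ 3F ∷ 2F ∷ 5F ∷ 4F ∷ [])
τ₆ = lookup (5F ∷ 2F ∷ 1F ∷ 4F ∷ 3F ∷ 0F ∷ [])

σ₈ τ₈ : Fin 8 → Fin 8
σ₈ = lookup (1F ∷ 0F ∷ 3F ∷ 2F ∷ 5F ∷ 4F ∷ 7F ∷ 6F ∷ [])
τ₈ = lookup (7F ∷ 2F ∷ 1F ∷ 4F ∷ 3F ∷ 6F ∷ 5F ∷ 0F ∷ [])

module _ {n : ℕ} {G : Graph n} where

  record Cycle8 (M M′ : PerfectMatching G) : Set where
    field
      φ           : Fin 8 → Fin n
      φ-injective : ∀ {k l} → φ k ≡ φ l → k ≡ l
      M∼σ₈        : Represents φ M σ₈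
      M′∼τ₈       : Represents φ M′ τ₈
    open Framed {G = G} φ φ-injective public
    field
      agree       : ∀ u → ¬ Inside u → partner M u ≡ partner M′ u

  partner-free : (M : PerfectMatching G) → FreeInvolution (partner M)
  partner-free M = record { involutive = partner-involutive M ; fixed-point-free = partner-≢ M }

  module AlternatingCycle (M M′ : PerfectMatching G) (a : Fin n) (a-mismatch : partner M a ≢ partner M′ a) where

    private
      p q : Fin n → Fin n
      p = partner M
      q = partner M′
      p² : ∀ u → p (p u) ≡ u
      p² = partner-involutive M
      q² : ∀ u → q (q u) ≡ u
      q² = partner-involutive M′

    w : ℕ → Fin n
    w = alternate p q a

    NoReturn : ℕ → Set
    NoReturn c = ∀ d → 0 < d → d < c → w (d * 2) ≢ a

    no-return-2 : NoReturn 2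
    no-return-2 1 _ _ qpa≡a = a-mismatch (trans (sym (q² (p a))) (cong q qpa≡a))
    no-return-2 (suc (suc _)) _ (s≤s (s≤s ()))

    no-return-suc : ∀ {c} → NoReturn c → w (c * 2) ≢ a → NoReturn (suc c)
    no-return-suc no-return w2c≢a d 0<d d<1+c with m<1+n⇒m<n∨m≡n d<1+c
    ... | inj₁ d<c  = no-return d 0<d d<c
    ... | inj₂ refl = w2c≢a

    frame : (ℓ : ℕ) → Fin ℓ → Fin n
    frame ℓ k = w (toℕ k)

    frame-injective : ∀ {c ℓ} → NoReturn c → ℓ ≤ c * 2 → ∀ {k l : Fin ℓ} → frame ℓ k ≡ frame ℓ l → k ≡ l
    frame-injective {c} no-return ℓ≤2c {k} {l} eq = toℕ-injective
      (alternate-injective (partner-free M) (partner-free M′) a c no-return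
         (<-≤-trans (toℕ<n k) ℓ≤2c) (<-≤-trans (toℕ<n l) ℓ≤2c) eq)

    cycle4 : w 4 ≡ a → Represents (frame 4) M σ₄ × Represents (frame 4) M′ τ₄
    cycle4 closes = represents (λ { 0F → refl ; 1F → p² _ ; 2F → refl ; 3F → p² _ })
                  , represents (λ { 0F → trans (cong q (sym closes)) (q² _) ; 1F → refl ; 2F → q² _ ; 3F → closes })

    cycle6 : w 6 ≡ a → Represents (frame 6) M σ₆ × Represents (frame 6) M′ τ₆
    cycle6 closes = represents (λ { 0F → refl ; 1F → p² _ ; 2F → refl ; 3F → p² _ ; 4F → refl ; 5F → p² _ })
                  , represents (λ { 0F → trans (cong q (sym closes)) (q² _) ; 1F → refl ; 2F → q² _ ; 3F → refl
                                  ; 4F → q² _ ; 5F → closes })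

    cycle8 : w 8 ≡ a → Represents (frame 8) M σ₈ × Represents (frame 8) M′ τ₈
    cycle8 closes = represents (λ { 0F → refl ; 1F → p² _ ; 2F → refl ; 3F → p² _ ; 4F → refl ; 5F → p² _
                                  ; 6F → refl ; 7F → p² _ })
                  , represents (λ { 0F → trans (cong q (sym closes)) (q² _) ; 1F → refl ; 2F → q² _ ; 3F → refl
                                  ; 4F → q² _ ; 5F → refl ; 6F → q² _ ; 7F → closes })

    mismatch-everywhere : ∀ i → p (w i) ≢ q (w i)
    mismatch-everywhere = alternate-mismatch (partner-free M) (partner-free M′) a-mismatch

    nine-mismatches : NoReturn 5 → 9 ≤ hamming p q
    nine-mismatches no-return = subst (_≤ hamming p q) (trans (sum-cong-≗ one) (sum-const 9 1)) (sum-frame-≥ _)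
      where
      open Frame (frame 9) (frame-injective no-return (s≤s (s≤s (s≤s (s≤s (s≤s (s≤s (s≤s (s≤s (s≤s z≤n))))))))))
      one : ∀ k → 𝟙 (not (p (frame 9 k) ≟ᵇ q (frame 9 k))) ≡ 1
      one k = cong (λ b → 𝟙 (not b)) (dec-false (_ ≟ _) (mismatch-everywhere (toℕ k)))

    reduce : hamming p q ≤ 8 → (Cycle8 M M′ → Star Switch3 M M′) → Star Switch3 M M′
    reduce ≤8 on-cycle8 with w 4 ≟ a
    ... | yes closes = Framed.switch-frame-then-outside (frame 4) (frame-injective no-return-2 ≤-refl) M M′
                         (proj₁ (cycle4 closes)) (proj₂ (cycle4 closes)) ≤-eval (≤-trans ≤8 ≤-eval)
    ... | no  open₄ with w 6 ≟ a
    ...   | yes closes = Framed.switch-frame-then-outside (frame 6) (frame-injective no-return-3 ≤-refl) M M′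
                           (proj₁ (cycle6 closes)) (proj₂ (cycle6 closes)) ≤-eval (≤-trans ≤8 ≤-eval)
      where
      no-return-3 : NoReturn 3
      no-return-3 = no-return-suc no-return-2 open₄
    ...   | no  open₆ with w 8 ≟ a
    ...     | yes closes = on-cycle8 cycle
      where
      no-return-4 : NoReturn 4
      no-return-4 = no-return-suc (no-return-suc no-return-2 open₄) open₆
      open Framed {G = G} (frame 8) (frame-injective no-return-4 ≤-refl)
      outside≡0 : outsideHamming p q ≡ 0
      outside≡0 = n≤0⇒n≡0 (+-cancelˡ-≤ 8 _ 0 (subst (_≤ 8) (hamming-frame (proj₁ (cycle8 closes)) (proj₂ (cycle8 closes))) ≤8))
      cycle : Cycle8 M M′
      cycle = record
        { φ = frame 8 ; φ-injective = frame-injective no-return-4 ≤-refl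
        ; M∼σ₈ = proj₁ (cycle8 closes) ; M′∼τ₈ = proj₂ (cycle8 closes)
        ; agree = outsideHamming≡0⇒agree outside≡0 }
    ...     | no  open₈ = ⊥-elim (<⇒≱ (s≤s ≤-refl) (≤-trans (nine-mismatches no-return-5) ≤8))
      where
      no-return-5 : NoReturn 5
      no-return-5 = no-return-suc (no-return-suc (no-return-suc no-return-2 open₄) open₆) open₈

  reduce-to-cycle8 : (M M′ : PerfectMatching G) → hamming (partner M) (partner M′) ≤ 8 →
                     (Cycle8 M M′ → Star Switch3 M M′) → Star Switch3 M M′
  reduce-to-cycle8 M M′ ≤8 on-cycle8 with hamming (partner M) (partner M′) ≤? 6
  ... | yes ≤6 = subst (_≤ 6) (sym (symDiff≡hamming M M′)) ≤6 ◅ ε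
  ... | no  ≰6 with sum-<⇒∃< {f = λ _ → 0} (subst (_< hamming (partner M) (partner M′)) (sym (sum-zeros {f = λ (_ : Fin n) → 0} (λ _ → refl))) (≤-trans (s≤s z≤n) (≰⇒> ≰6)))
  ...   | a , 0<𝟙 = AlternatingCycle.reduce M M′ a (𝟙⇒≢ 0<𝟙) ≤8 on-cycle8
    where
    𝟙⇒≢ : ∀ {x y : Fin n} → 0 < 𝟙 (not (x ≟ᵇ y)) → x ≢ y
    𝟙⇒≢ {x} {y} 0<𝟙 x≡y rewrite dec-true (x ≟ y) x≡y with () ← 0<𝟙


next : Fin 8 → Fin 8
next = lookup (1F ∷ 2F ∷ 3F ∷ 4F ∷ 5F ∷ 6F ∷ 7F ∷ 0F ∷ [])

infixl 8 _⊕_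
_⊕_ : Fin 8 → ℕ → Fin 8
k ⊕ j = iterate next k j

⊕-+ : ∀ k i j → k ⊕ i ⊕ j ≡ k ⊕ (i + j)
⊕-+ k zero    j = refl
⊕-+ k (suc i) j = ⊕-+ (next k) i j

⊕-8 : ∀ k → k ⊕ 8 ≡ k
⊕-8 = λ { 0F → refl ; 1F → refl ; 2F → refl ; 3F → refl ; 4F → refl ; 5F → refl ; 6F → refl ; 7F → refl }

0F⊕toℕ : ∀ l → 0F ⊕ toℕ l ≡ l
0F⊕toℕ = does⇒ (all? (λ l → 0F ⊕ toℕ l ≟ l)) _

next-on-cycle : ∀ k → next k ≡ σ₈ k ⊎ next k ≡ τ₈ k
next-on-cycle = λ { 0F → inj₁ refl ; 1F → inj₂ refl ; 2F → inj₁ refl ; 3F → inj₂ refl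
                  ; 4F → inj₁ refl ; 5F → inj₂ refl ; 6F → inj₁ refl ; 7F → inj₂ refl }

-- Switching across the chord {k, k+3}: replace the two edges of the 8-cycle's matching that the chord
-- closes into a 4-cycle.
chordMatching : Fin 8 → Fin 8 → Fin 8
chordMatching k = lookup (lookup table k)
  where
  table : Vec (Vec (Fin 8) 8) 8
  table = (3F ∷ 2F ∷ 1F ∷ 0F ∷ 5F ∷ 4F ∷ 7F ∷ 6F ∷ [])
        ∷ (7F ∷ 4F ∷ 3F ∷ 2F ∷ 1F ∷ 6F ∷ 5F ∷ 0F ∷ [])
        ∷ (1F ∷ 0F ∷ 5F ∷ 4F ∷ 3F ∷ 2F ∷ 7F ∷ 6F ∷ [])
        ∷ (7F ∷ 2F ∷ 1F ∷ 6F ∷ 5F ∷ 4F ∷ 3F ∷ 0F ∷ [])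
        ∷ (1F ∷ 0F ∷ 3F ∷ 2F ∷ 7F ∷ 6F ∷ 5F ∷ 4F ∷ [])
        ∷ (5F ∷ 2F ∷ 1F ∷ 4F ∷ 3F ∷ 0F ∷ 7F ∷ 6F ∷ [])
        ∷ (7F ∷ 6F ∷ 3F ∷ 2F ∷ 5F ∷ 4F ∷ 1F ∷ 0F ∷ [])
        ∷ (1F ∷ 0F ∷ 7F ∷ 4F ∷ 3F ∷ 6F ∷ 5F ∷ 2F ∷ [])
        ∷ []

chordCertificate : Fin 8 → Certificate 8
chordCertificate k = certificate ((k , k ⊕ 3) ∷ []) (chordMatching k ∷ [])

chordCertificate-valid : ∀ k → Valid σ₈ τ₈ (chordCertificate k)
chordCertificate-valid = does⇒ (all? (λ k → T? (isValid σ₈ τ₈ (chordCertificate k)))) _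

-- The positions k ⊕ j, j ∈ js, of the cycle: there a vertex has no neighbour.
holes : List ℕ → Fin 8 → Fin 8 → Bool
holes js k l = any (λ j → l ≟ᵇ k ⊕ j) js

freePositions : List ℕ → Fin 8 → ℕ
freePositions js k = sum (λ l → 𝟙 (not (holes js k l)))

freePositions-ore : ∀ k → freePositions (0 ∷ 3 ∷ 5 ∷ []) k ≡ 5
freePositions-ore = does⇒ (all? (λ k → freePositions (0 ∷ 3 ∷ 5 ∷ []) k ≟ℕ 5)) _

freePositions-bipartite : ∀ k → freePositions (0 ∷ 2 ∷ 4 ∷ 6 ∷ 3 ∷ 5 ∷ []) k ≡ 2
freePositions-bipartite = does⇒ (all? (λ k → freePositions (0 ∷ 2 ∷ 4 ∷ 6 ∷ 3 ∷ 5 ∷ []) k ≟ℕ 2)) _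

⊕3-≢ : ∀ k → k ≢ k ⊕ 3
⊕3-≢ = does⇒ (all? (λ k → ¬? (k ≟ k ⊕ 3))) _

evens : Fin 4 → Fin 8
evens = lookup (0F ∷ 2F ∷ 4F ∷ 6F ∷ [])

-- The chords {0,3}, {2,5}, {4,7}, {6,1} partition the cycle.
sum-by-chords : (d : Fin 8 → ℕ) → sum d ≡ sum (λ j → d (evens j) + d (evens j ⊕ 3))
sum-by-chords d = solve 8 (λ d₀ d₁ d₂ d₃ d₄ d₅ d₆ d₇ →
    d₀ :+ (d₁ :+ (d₂ :+ (d₃ :+ (d₄ :+ (d₅ :+ (d₆ :+ (d₇ :+ con 0)))))))
    := (d₀ :+ d₃) :+ ((d₂ :+ d₅) :+ ((d₄ :+ d₇) :+ ((d₆ :+ d₁) :+ con 0))))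
  refl (d 0F) (d 1F) (d 2F) (d 3F) (d 4F) (d 5F) (d 6F) (d 7F)

ore-count : ∀ w C E → 4 * (8 + w + 3) ≤ C + E → C ≤ 40 → 8 * w < E + E
ore-count w C E ≤C+E C≤40 =
  ≤-trans (s≤s (m≤n+m (8 * w) 7)) (subst (_≤ E + E) (solve 1 (λ w → (con 4 :+ con 4 :* w) :+ (con 4 :+ con 4 :* w) := con 8 :+ con 8 :* w) refl w)
                                          (+-mono-≤ 4+4w≤E 4+4w≤E))
  where
  4+4w≤E : 4 + 4 * w ≤ E
  4+4w≤E = +-cancelˡ-≤ 40 _ _ (subst (_≤ 40 + E) (solve 1 (λ w → con 4 :* (con 8 :+ w :+ con 3) := con 40 :+ (con 4 :+ con 4 :* w)) refl w)
                                     (≤-trans ≤C+E (+-monoˡ-≤ E C≤40)))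

bipartite-count : ∀ h w C E → 8 + w ≡ h + h → 4 * (h + 1) ≤ C + E → C ≤ 16 → 4 * w < E + E
bipartite-count h w C E 8+w≡2h ≤C+E C≤16 = ≤-trans (s≤s (m≤n+m (4 * w) 7)) (+-cancelˡ-≤ 32 _ _ (subst₂ _≤_ lhs rhs (+-mono-≤ ≤16+E ≤16+E)))
  where
  ≤16+E : 4 * (h + 1) ≤ 16 + E
  ≤16+E = ≤-trans ≤C+E (+-monoˡ-≤ E C≤16)
  lhs : 4 * (h + 1) + 4 * (h + 1) ≡ 32 + (8 + 4 * w)
  lhs = trans (solve 1 (λ h → con 4 :* (h :+ con 1) :+ con 4 :* (h :+ con 1) := con 4 :* (h :+ h) :+ con 8) refl h)
       (trans (cong (λ x → 4 * x + 8) (sym 8+w≡2h)) (solve 1 (λ w → con 4 :* (con 8 :+ w) :+ con 8 := con 32 :+ (con 8 :+ con 4 :* w)) refl w))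
  rhs : (16 + E) + (16 + E) ≡ 32 + (E + E)
  rhs = solve 1 (λ E → (con 16 :+ E) :+ (con 16 :+ E) := con 32 :+ (E :+ E)) refl E

-- The frame of an 8-cycle (positions 2, …, 9) together with an outside M-edge {0, 1}.
σ₁₀ τ₁₀ : Fin 10 → Fin 10
σ₁₀ 0F            = 1F
σ₁₀ 1F            = 0F
σ₁₀ (suc (suc k)) = suc (suc (σ₈ k))
τ₁₀ 0F            = 1F
τ₁₀ 1F            = 0F
τ₁₀ (suc (suc k)) = suc (suc (τ₈ k))

-- Row i lists the cycle neighbours of the outside vertex i.
Attachment : Set
Attachment = Vec (Vec Bool 8) 2

record Switching : Set where
  constructor switching
  field
    uses          : List (Fin 2 × Fin 8)
    first second  : Vec (Fin 10) 10

  certificate₁₀ : Certificate 10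
  certificate₁₀ = certificate (map (λ (i , l) → i ↑ˡ 8 , 2 ↑ʳ l) uses) (lookup first ∷ lookup second ∷ [])

  appliesTo : Attachment → Bool
  appliesTo att = all (λ (i , l) → lookup (lookup att i) l) uses

open Switching public

switchings : List Switching
switchings =
  switching ((0F , 3F) ∷ (1F , 0F) ∷ (1F , 4F) ∷ [])
      (5F ∷ 2F ∷ 1F ∷ 4F ∷ 3F ∷ 0F ∷ 7F ∷ 6F ∷ 9F ∷ 8F ∷ []) (5F ∷ 6F ∷ 9F ∷ 4F ∷ 3F ∷ 0F ∷ 1F ∷ 8F ∷ 7F ∷ 2F ∷ [])
  ∷ switching ((0F , 3F) ∷ (1F , 0F) ∷ (0F , 5F) ∷ [])
      (5F ∷ 2F ∷ 1F ∷ 4F ∷ 3F ∷ 0F ∷ 7F ∷ 6F ∷ 9F ∷ 8F ∷ []) (7F ∷ 2F ∷ 1F ∷ 4F ∷ 3F ∷ 6F ∷ 5F ∷ 0F ∷ 9F ∷ 8F ∷ [])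
  ∷ switching ((0F , 3F) ∷ (1F , 0F) ∷ (1F , 6F) ∷ [])
      (5F ∷ 2F ∷ 1F ∷ 4F ∷ 3F ∷ 0F ∷ 7F ∷ 6F ∷ 9F ∷ 8F ∷ []) (5F ∷ 8F ∷ 9F ∷ 4F ∷ 3F ∷ 0F ∷ 7F ∷ 6F ∷ 1F ∷ 2F ∷ [])
  ∷ switching ((0F , 3F) ∷ (1F , 0F) ∷ (0F , 7F) ∷ [])
      (5F ∷ 2F ∷ 1F ∷ 4F ∷ 3F ∷ 0F ∷ 7F ∷ 6F ∷ 9F ∷ 8F ∷ []) (9F ∷ 2F ∷ 1F ∷ 4F ∷ 3F ∷ 6F ∷ 5F ∷ 8F ∷ 7F ∷ 0F ∷ [])
  ∷ switching ((0F , 4F) ∷ (1F , 1F) ∷ (1F , 5F) ∷ [])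
      (6F ∷ 7F ∷ 3F ∷ 2F ∷ 5F ∷ 4F ∷ 0F ∷ 1F ∷ 9F ∷ 8F ∷ []) (6F ∷ 3F ∷ 9F ∷ 1F ∷ 5F ∷ 4F ∷ 0F ∷ 8F ∷ 7F ∷ 2F ∷ [])
  ∷ switching ((0F , 4F) ∷ (1F , 1F) ∷ (0F , 6F) ∷ [])
      (8F ∷ 3F ∷ 9F ∷ 1F ∷ 5F ∷ 4F ∷ 7F ∷ 6F ∷ 0F ∷ 2F ∷ []) (6F ∷ 3F ∷ 9F ∷ 1F ∷ 5F ∷ 4F ∷ 0F ∷ 8F ∷ 7F ∷ 2F ∷ [])
  ∷ switching ((0F , 4F) ∷ (1F , 1F) ∷ (1F , 7F) ∷ [])
      (6F ∷ 9F ∷ 3F ∷ 2F ∷ 5F ∷ 4F ∷ 0F ∷ 8F ∷ 7F ∷ 1F ∷ []) (6F ∷ 3F ∷ 9F ∷ 1F ∷ 5F ∷ 4F ∷ 0F ∷ 8F ∷ 7F ∷ 2F ∷ [])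
  ∷ switching ((0F , 4F) ∷ (1F , 1F) ∷ (0F , 0F) ∷ [])
      (2F ∷ 3F ∷ 0F ∷ 1F ∷ 5F ∷ 4F ∷ 7F ∷ 6F ∷ 9F ∷ 8F ∷ []) (6F ∷ 3F ∷ 9F ∷ 1F ∷ 5F ∷ 4F ∷ 0F ∷ 8F ∷ 7F ∷ 2F ∷ [])
  ∷ switching ((0F , 5F) ∷ (1F , 2F) ∷ (1F , 6F) ∷ [])
      (7F ∷ 4F ∷ 3F ∷ 2F ∷ 1F ∷ 6F ∷ 5F ∷ 0F ∷ 9F ∷ 8F ∷ []) (7F ∷ 8F ∷ 9F ∷ 4F ∷ 3F ∷ 6F ∷ 5F ∷ 0F ∷ 1F ∷ 2F ∷ [])
  ∷ switching ((0F , 5F) ∷ (1F , 2F) ∷ (0F , 7F) ∷ [])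
      (7F ∷ 4F ∷ 3F ∷ 2F ∷ 1F ∷ 6F ∷ 5F ∷ 0F ∷ 9F ∷ 8F ∷ []) (9F ∷ 4F ∷ 3F ∷ 2F ∷ 1F ∷ 6F ∷ 5F ∷ 8F ∷ 7F ∷ 0F ∷ [])
  ∷ switching ((0F , 5F) ∷ (1F , 2F) ∷ (1F , 0F) ∷ [])
      (7F ∷ 4F ∷ 3F ∷ 2F ∷ 1F ∷ 6F ∷ 5F ∷ 0F ∷ 9F ∷ 8F ∷ []) (7F ∷ 2F ∷ 1F ∷ 4F ∷ 3F ∷ 6F ∷ 5F ∷ 0F ∷ 9F ∷ 8F ∷ [])
  ∷ switching ((0F , 5F) ∷ (1F , 2F) ∷ (0F , 1F) ∷ [])
      (7F ∷ 4F ∷ 3F ∷ 2F ∷ 1F ∷ 6F ∷ 5F ∷ 0F ∷ 9F ∷ 8F ∷ []) (3F ∷ 4F ∷ 9F ∷ 0F ∷ 1F ∷ 6F ∷ 5F ∷ 8F ∷ 7F ∷ 2F ∷ [])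
  ∷ switching ((0F , 6F) ∷ (1F , 3F) ∷ (1F , 7F) ∷ [])
      (8F ∷ 9F ∷ 3F ∷ 2F ∷ 5F ∷ 4F ∷ 7F ∷ 6F ∷ 0F ∷ 1F ∷ []) (8F ∷ 5F ∷ 9F ∷ 4F ∷ 3F ∷ 1F ∷ 7F ∷ 6F ∷ 0F ∷ 2F ∷ [])
  ∷ switching ((0F , 6F) ∷ (1F , 3F) ∷ (0F , 0F) ∷ [])
      (2F ∷ 5F ∷ 0F ∷ 4F ∷ 3F ∷ 1F ∷ 7F ∷ 6F ∷ 9F ∷ 8F ∷ []) (8F ∷ 5F ∷ 9F ∷ 4F ∷ 3F ∷ 1F ∷ 7F ∷ 6F ∷ 0F ∷ 2F ∷ [])
  ∷ switching ((0F , 6F) ∷ (1F , 3F) ∷ (1F , 1F) ∷ [])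
      (8F ∷ 3F ∷ 9F ∷ 1F ∷ 5F ∷ 4F ∷ 7F ∷ 6F ∷ 0F ∷ 2F ∷ []) (8F ∷ 5F ∷ 9F ∷ 4F ∷ 3F ∷ 1F ∷ 7F ∷ 6F ∷ 0F ∷ 2F ∷ [])
  ∷ switching ((0F , 6F) ∷ (1F , 3F) ∷ (0F , 2F) ∷ [])
      (4F ∷ 5F ∷ 3F ∷ 2F ∷ 0F ∷ 1F ∷ 7F ∷ 6F ∷ 9F ∷ 8F ∷ []) (8F ∷ 5F ∷ 9F ∷ 4F ∷ 3F ∷ 1F ∷ 7F ∷ 6F ∷ 0F ∷ 2F ∷ [])
  ∷ switching ((0F , 7F) ∷ (1F , 4F) ∷ (1F , 0F) ∷ [])
      (9F ∷ 6F ∷ 3F ∷ 2F ∷ 5F ∷ 4F ∷ 1F ∷ 8F ∷ 7F ∷ 0F ∷ []) (9F ∷ 2F ∷ 1F ∷ 4F ∷ 3F ∷ 6F ∷ 5F ∷ 8F ∷ 7F ∷ 0F ∷ [])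
  ∷ switching ((0F , 7F) ∷ (1F , 4F) ∷ (0F , 1F) ∷ [])
      (9F ∷ 6F ∷ 3F ∷ 2F ∷ 5F ∷ 4F ∷ 1F ∷ 8F ∷ 7F ∷ 0F ∷ []) (3F ∷ 6F ∷ 9F ∷ 0F ∷ 5F ∷ 4F ∷ 1F ∷ 8F ∷ 7F ∷ 2F ∷ [])
  ∷ switching ((0F , 7F) ∷ (1F , 4F) ∷ (1F , 2F) ∷ [])
      (9F ∷ 6F ∷ 3F ∷ 2F ∷ 5F ∷ 4F ∷ 1F ∷ 8F ∷ 7F ∷ 0F ∷ []) (9F ∷ 4F ∷ 3F ∷ 2F ∷ 1F ∷ 6F ∷ 5F ∷ 8F ∷ 7F ∷ 0F ∷ [])
  ∷ switching ((0F , 7F) ∷ (1F , 4F) ∷ (0F , 3F) ∷ [])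
      (9F ∷ 6F ∷ 3F ∷ 2F ∷ 5F ∷ 4F ∷ 1F ∷ 8F ∷ 7F ∷ 0F ∷ []) (5F ∷ 6F ∷ 9F ∷ 4F ∷ 3F ∷ 0F ∷ 1F ∷ 8F ∷ 7F ∷ 2F ∷ [])
  ∷ switching ((0F , 0F) ∷ (1F , 5F) ∷ (1F , 1F) ∷ [])
      (2F ∷ 3F ∷ 0F ∷ 1F ∷ 5F ∷ 4F ∷ 7F ∷ 6F ∷ 9F ∷ 8F ∷ []) (2F ∷ 7F ∷ 0F ∷ 4F ∷ 3F ∷ 6F ∷ 5F ∷ 1F ∷ 9F ∷ 8F ∷ [])
  ∷ switching ((0F , 0F) ∷ (1F , 5F) ∷ (0F , 2F) ∷ [])
      (4F ∷ 7F ∷ 3F ∷ 2F ∷ 0F ∷ 6F ∷ 5F ∷ 1F ∷ 9F ∷ 8F ∷ []) (2F ∷ 7F ∷ 0F ∷ 4F ∷ 3F ∷ 6F ∷ 5F ∷ 1F ∷ 9F ∷ 8F ∷ [])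
  ∷ switching ((0F , 0F) ∷ (1F , 5F) ∷ (1F , 3F) ∷ [])
      (2F ∷ 5F ∷ 0F ∷ 4F ∷ 3F ∷ 1F ∷ 7F ∷ 6F ∷ 9F ∷ 8F ∷ []) (2F ∷ 7F ∷ 0F ∷ 4F ∷ 3F ∷ 6F ∷ 5F ∷ 1F ∷ 9F ∷ 8F ∷ [])
  ∷ switching ((0F , 0F) ∷ (1F , 5F) ∷ (0F , 4F) ∷ [])
      (6F ∷ 7F ∷ 3F ∷ 2F ∷ 5F ∷ 4F ∷ 0F ∷ 1F ∷ 9F ∷ 8F ∷ []) (2F ∷ 7F ∷ 0F ∷ 4F ∷ 3F ∷ 6F ∷ 5F ∷ 1F ∷ 9F ∷ 8F ∷ [])
  ∷ switching ((0F , 1F) ∷ (1F , 6F) ∷ (1F , 2F) ∷ [])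
      (3F ∷ 8F ∷ 9F ∷ 0F ∷ 5F ∷ 4F ∷ 7F ∷ 6F ∷ 1F ∷ 2F ∷ []) (3F ∷ 4F ∷ 9F ∷ 0F ∷ 1F ∷ 6F ∷ 5F ∷ 8F ∷ 7F ∷ 2F ∷ [])
  ∷ switching ((0F , 1F) ∷ (1F , 6F) ∷ (0F , 3F) ∷ [])
      (3F ∷ 8F ∷ 9F ∷ 0F ∷ 5F ∷ 4F ∷ 7F ∷ 6F ∷ 1F ∷ 2F ∷ []) (5F ∷ 8F ∷ 9F ∷ 4F ∷ 3F ∷ 0F ∷ 7F ∷ 6F ∷ 1F ∷ 2F ∷ [])
  ∷ switching ((0F , 1F) ∷ (1F , 6F) ∷ (1F , 4F) ∷ [])
      (3F ∷ 8F ∷ 9F ∷ 0F ∷ 5F ∷ 4F ∷ 7F ∷ 6F ∷ 1F ∷ 2F ∷ []) (3F ∷ 6F ∷ 9F ∷ 0F ∷ 5F ∷ 4F ∷ 1F ∷ 8F ∷ 7F ∷ 2F ∷ [])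
  ∷ switching ((0F , 1F) ∷ (1F , 6F) ∷ (0F , 5F) ∷ [])
      (3F ∷ 8F ∷ 9F ∷ 0F ∷ 5F ∷ 4F ∷ 7F ∷ 6F ∷ 1F ∷ 2F ∷ []) (7F ∷ 8F ∷ 9F ∷ 4F ∷ 3F ∷ 6F ∷ 5F ∷ 0F ∷ 1F ∷ 2F ∷ [])
  ∷ switching ((0F , 2F) ∷ (1F , 7F) ∷ (1F , 3F) ∷ [])
      (4F ∷ 5F ∷ 3F ∷ 2F ∷ 0F ∷ 1F ∷ 7F ∷ 6F ∷ 9F ∷ 8F ∷ []) (4F ∷ 9F ∷ 3F ∷ 2F ∷ 0F ∷ 6F ∷ 5F ∷ 8F ∷ 7F ∷ 1F ∷ [])
  ∷ switching ((0F , 2F) ∷ (1F , 7F) ∷ (0F , 4F) ∷ [])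
      (6F ∷ 9F ∷ 3F ∷ 2F ∷ 5F ∷ 4F ∷ 0F ∷ 8F ∷ 7F ∷ 1F ∷ []) (4F ∷ 9F ∷ 3F ∷ 2F ∷ 0F ∷ 6F ∷ 5F ∷ 8F ∷ 7F ∷ 1F ∷ [])
  ∷ switching ((0F , 2F) ∷ (1F , 7F) ∷ (1F , 5F) ∷ [])
      (4F ∷ 7F ∷ 3F ∷ 2F ∷ 0F ∷ 6F ∷ 5F ∷ 1F ∷ 9F ∷ 8F ∷ []) (4F ∷ 9F ∷ 3F ∷ 2F ∷ 0F ∷ 6F ∷ 5F ∷ 8F ∷ 7F ∷ 1F ∷ [])
  ∷ switching ((0F , 2F) ∷ (1F , 7F) ∷ (0F , 6F) ∷ [])
      (8F ∷ 9F ∷ 3F ∷ 2F ∷ 5F ∷ 4F ∷ 7F ∷ 6F ∷ 0F ∷ 1F ∷ []) (4F ∷ 9F ∷ 3F ∷ 2F ∷ 0F ∷ 6F ∷ 5F ∷ 8F ∷ 7F ∷ 1F ∷ [])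
  ∷ switching ((1F , 3F) ∷ (0F , 0F) ∷ (0F , 4F) ∷ [])
      (2F ∷ 5F ∷ 0F ∷ 4F ∷ 3F ∷ 1F ∷ 7F ∷ 6F ∷ 9F ∷ 8F ∷ []) (6F ∷ 5F ∷ 9F ∷ 4F ∷ 3F ∷ 1F ∷ 0F ∷ 8F ∷ 7F ∷ 2F ∷ [])
  ∷ switching ((1F , 3F) ∷ (0F , 0F) ∷ (1F , 5F) ∷ [])
      (2F ∷ 5F ∷ 0F ∷ 4F ∷ 3F ∷ 1F ∷ 7F ∷ 6F ∷ 9F ∷ 8F ∷ []) (2F ∷ 7F ∷ 0F ∷ 4F ∷ 3F ∷ 6F ∷ 5F ∷ 1F ∷ 9F ∷ 8F ∷ [])
  ∷ switching ((1F , 3F) ∷ (0F , 0F) ∷ (0F , 6F) ∷ [])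
      (2F ∷ 5F ∷ 0F ∷ 4F ∷ 3F ∷ 1F ∷ 7F ∷ 6F ∷ 9F ∷ 8F ∷ []) (8F ∷ 5F ∷ 9F ∷ 4F ∷ 3F ∷ 1F ∷ 7F ∷ 6F ∷ 0F ∷ 2F ∷ [])
  ∷ switching ((1F , 3F) ∷ (0F , 0F) ∷ (1F , 7F) ∷ [])
      (2F ∷ 5F ∷ 0F ∷ 4F ∷ 3F ∷ 1F ∷ 7F ∷ 6F ∷ 9F ∷ 8F ∷ []) (2F ∷ 9F ∷ 0F ∷ 4F ∷ 3F ∷ 6F ∷ 5F ∷ 8F ∷ 7F ∷ 1F ∷ [])
  ∷ switching ((1F , 4F) ∷ (0F , 1F) ∷ (0F , 5F) ∷ [])
      (7F ∷ 6F ∷ 3F ∷ 2F ∷ 5F ∷ 4F ∷ 1F ∷ 0F ∷ 9F ∷ 8F ∷ []) (3F ∷ 6F ∷ 9F ∷ 0F ∷ 5F ∷ 4F ∷ 1F ∷ 8F ∷ 7F ∷ 2F ∷ [])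
  ∷ switching ((1F , 4F) ∷ (0F , 1F) ∷ (1F , 6F) ∷ [])
      (3F ∷ 8F ∷ 9F ∷ 0F ∷ 5F ∷ 4F ∷ 7F ∷ 6F ∷ 1F ∷ 2F ∷ []) (3F ∷ 6F ∷ 9F ∷ 0F ∷ 5F ∷ 4F ∷ 1F ∷ 8F ∷ 7F ∷ 2F ∷ [])
  ∷ switching ((1F , 4F) ∷ (0F , 1F) ∷ (0F , 7F) ∷ [])
      (9F ∷ 6F ∷ 3F ∷ 2F ∷ 5F ∷ 4F ∷ 1F ∷ 8F ∷ 7F ∷ 0F ∷ []) (3F ∷ 6F ∷ 9F ∷ 0F ∷ 5F ∷ 4F ∷ 1F ∷ 8F ∷ 7F ∷ 2F ∷ [])
  ∷ switching ((1F , 4F) ∷ (0F , 1F) ∷ (1F , 0F) ∷ [])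
      (3F ∷ 2F ∷ 1F ∷ 0F ∷ 5F ∷ 4F ∷ 7F ∷ 6F ∷ 9F ∷ 8F ∷ []) (3F ∷ 6F ∷ 9F ∷ 0F ∷ 5F ∷ 4F ∷ 1F ∷ 8F ∷ 7F ∷ 2F ∷ [])
  ∷ switching ((1F , 5F) ∷ (0F , 2F) ∷ (0F , 6F) ∷ [])
      (4F ∷ 7F ∷ 3F ∷ 2F ∷ 0F ∷ 6F ∷ 5F ∷ 1F ∷ 9F ∷ 8F ∷ []) (8F ∷ 7F ∷ 9F ∷ 4F ∷ 3F ∷ 6F ∷ 5F ∷ 1F ∷ 0F ∷ 2F ∷ [])
  ∷ switching ((1F , 5F) ∷ (0F , 2F) ∷ (1F , 7F) ∷ [])
      (4F ∷ 7F ∷ 3F ∷ 2F ∷ 0F ∷ 6F ∷ 5F ∷ 1F ∷ 9F ∷ 8F ∷ []) (4F ∷ 9F ∷ 3F ∷ 2F ∷ 0F ∷ 6F ∷ 5F ∷ 8F ∷ 7F ∷ 1F ∷ [])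
  ∷ switching ((1F , 5F) ∷ (0F , 2F) ∷ (0F , 0F) ∷ [])
      (4F ∷ 7F ∷ 3F ∷ 2F ∷ 0F ∷ 6F ∷ 5F ∷ 1F ∷ 9F ∷ 8F ∷ []) (2F ∷ 7F ∷ 0F ∷ 4F ∷ 3F ∷ 6F ∷ 5F ∷ 1F ∷ 9F ∷ 8F ∷ [])
  ∷ switching ((1F , 5F) ∷ (0F , 2F) ∷ (1F , 1F) ∷ [])
      (4F ∷ 7F ∷ 3F ∷ 2F ∷ 0F ∷ 6F ∷ 5F ∷ 1F ∷ 9F ∷ 8F ∷ []) (4F ∷ 3F ∷ 9F ∷ 1F ∷ 0F ∷ 6F ∷ 5F ∷ 8F ∷ 7F ∷ 2F ∷ [])
  ∷ switching ((1F , 6F) ∷ (0F , 3F) ∷ (0F , 7F) ∷ [])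
      (9F ∷ 8F ∷ 3F ∷ 2F ∷ 5F ∷ 4F ∷ 7F ∷ 6F ∷ 1F ∷ 0F ∷ []) (5F ∷ 8F ∷ 9F ∷ 4F ∷ 3F ∷ 0F ∷ 7F ∷ 6F ∷ 1F ∷ 2F ∷ [])
  ∷ switching ((1F , 6F) ∷ (0F , 3F) ∷ (1F , 0F) ∷ [])
      (5F ∷ 2F ∷ 1F ∷ 4F ∷ 3F ∷ 0F ∷ 7F ∷ 6F ∷ 9F ∷ 8F ∷ []) (5F ∷ 8F ∷ 9F ∷ 4F ∷ 3F ∷ 0F ∷ 7F ∷ 6F ∷ 1F ∷ 2F ∷ [])
  ∷ switching ((1F , 6F) ∷ (0F , 3F) ∷ (0F , 1F) ∷ [])
      (3F ∷ 8F ∷ 9F ∷ 0F ∷ 5F ∷ 4F ∷ 7F ∷ 6F ∷ 1F ∷ 2F ∷ []) (5F ∷ 8F ∷ 9F ∷ 4F ∷ 3F ∷ 0F ∷ 7F ∷ 6F ∷ 1F ∷ 2F ∷ [])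
  ∷ switching ((1F , 6F) ∷ (0F , 3F) ∷ (1F , 2F) ∷ [])
      (5F ∷ 4F ∷ 3F ∷ 2F ∷ 1F ∷ 0F ∷ 7F ∷ 6F ∷ 9F ∷ 8F ∷ []) (5F ∷ 8F ∷ 9F ∷ 4F ∷ 3F ∷ 0F ∷ 7F ∷ 6F ∷ 1F ∷ 2F ∷ [])
  ∷ switching ((1F , 7F) ∷ (0F , 4F) ∷ (0F , 0F) ∷ [])
      (6F ∷ 9F ∷ 3F ∷ 2F ∷ 5F ∷ 4F ∷ 0F ∷ 8F ∷ 7F ∷ 1F ∷ []) (2F ∷ 9F ∷ 0F ∷ 4F ∷ 3F ∷ 6F ∷ 5F ∷ 8F ∷ 7F ∷ 1F ∷ [])
  ∷ switching ((1F , 7F) ∷ (0F , 4F) ∷ (1F , 1F) ∷ [])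
      (6F ∷ 9F ∷ 3F ∷ 2F ∷ 5F ∷ 4F ∷ 0F ∷ 8F ∷ 7F ∷ 1F ∷ []) (6F ∷ 3F ∷ 9F ∷ 1F ∷ 5F ∷ 4F ∷ 0F ∷ 8F ∷ 7F ∷ 2F ∷ [])
  ∷ switching ((1F , 7F) ∷ (0F , 4F) ∷ (0F , 2F) ∷ [])
      (6F ∷ 9F ∷ 3F ∷ 2F ∷ 5F ∷ 4F ∷ 0F ∷ 8F ∷ 7F ∷ 1F ∷ []) (4F ∷ 9F ∷ 3F ∷ 2F ∷ 0F ∷ 6F ∷ 5F ∷ 8F ∷ 7F ∷ 1F ∷ [])
  ∷ switching ((1F , 7F) ∷ (0F , 4F) ∷ (1F , 3F) ∷ [])
      (6F ∷ 9F ∷ 3F ∷ 2F ∷ 5F ∷ 4F ∷ 0F ∷ 8F ∷ 7F ∷ 1F ∷ []) (6F ∷ 5F ∷ 9F ∷ 4F ∷ 3F ∷ 1F ∷ 0F ∷ 8F ∷ 7F ∷ 2F ∷ [])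
  ∷ switching ((1F , 0F) ∷ (0F , 5F) ∷ (0F , 1F) ∷ [])
      (3F ∷ 2F ∷ 1F ∷ 0F ∷ 5F ∷ 4F ∷ 7F ∷ 6F ∷ 9F ∷ 8F ∷ []) (7F ∷ 2F ∷ 1F ∷ 4F ∷ 3F ∷ 6F ∷ 5F ∷ 0F ∷ 9F ∷ 8F ∷ [])
  ∷ switching ((1F , 0F) ∷ (0F , 5F) ∷ (1F , 2F) ∷ [])
      (7F ∷ 4F ∷ 3F ∷ 2F ∷ 1F ∷ 6F ∷ 5F ∷ 0F ∷ 9F ∷ 8F ∷ []) (7F ∷ 2F ∷ 1F ∷ 4F ∷ 3F ∷ 6F ∷ 5F ∷ 0F ∷ 9F ∷ 8F ∷ [])
  ∷ switching ((1F , 0F) ∷ (0F , 5F) ∷ (0F , 3F) ∷ [])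
      (5F ∷ 2F ∷ 1F ∷ 4F ∷ 3F ∷ 0F ∷ 7F ∷ 6F ∷ 9F ∷ 8F ∷ []) (7F ∷ 2F ∷ 1F ∷ 4F ∷ 3F ∷ 6F ∷ 5F ∷ 0F ∷ 9F ∷ 8F ∷ [])
  ∷ switching ((1F , 0F) ∷ (0F , 5F) ∷ (1F , 4F) ∷ [])
      (7F ∷ 6F ∷ 3F ∷ 2F ∷ 5F ∷ 4F ∷ 1F ∷ 0F ∷ 9F ∷ 8F ∷ []) (7F ∷ 2F ∷ 1F ∷ 4F ∷ 3F ∷ 6F ∷ 5F ∷ 0F ∷ 9F ∷ 8F ∷ [])
  ∷ switching ((1F , 1F) ∷ (0F , 6F) ∷ (0F , 2F) ∷ [])
      (8F ∷ 3F ∷ 9F ∷ 1F ∷ 5F ∷ 4F ∷ 7F ∷ 6F ∷ 0F ∷ 2F ∷ []) (4F ∷ 3F ∷ 9F ∷ 1F ∷ 0F ∷ 6F ∷ 5F ∷ 8F ∷ 7F ∷ 2F ∷ [])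
  ∷ switching ((1F , 1F) ∷ (0F , 6F) ∷ (1F , 3F) ∷ [])
      (8F ∷ 3F ∷ 9F ∷ 1F ∷ 5F ∷ 4F ∷ 7F ∷ 6F ∷ 0F ∷ 2F ∷ []) (8F ∷ 5F ∷ 9F ∷ 4F ∷ 3F ∷ 1F ∷ 7F ∷ 6F ∷ 0F ∷ 2F ∷ [])
  ∷ switching ((1F , 1F) ∷ (0F , 6F) ∷ (0F , 4F) ∷ [])
      (8F ∷ 3F ∷ 9F ∷ 1F ∷ 5F ∷ 4F ∷ 7F ∷ 6F ∷ 0F ∷ 2F ∷ []) (6F ∷ 3F ∷ 9F ∷ 1F ∷ 5F ∷ 4F ∷ 0F ∷ 8F ∷ 7F ∷ 2F ∷ [])
  ∷ switching ((1F , 1F) ∷ (0F , 6F) ∷ (1F , 5F) ∷ [])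
      (8F ∷ 3F ∷ 9F ∷ 1F ∷ 5F ∷ 4F ∷ 7F ∷ 6F ∷ 0F ∷ 2F ∷ []) (8F ∷ 7F ∷ 9F ∷ 4F ∷ 3F ∷ 6F ∷ 5F ∷ 1F ∷ 0F ∷ 2F ∷ [])
  ∷ switching ((1F , 2F) ∷ (0F , 7F) ∷ (0F , 3F) ∷ [])
      (5F ∷ 4F ∷ 3F ∷ 2F ∷ 1F ∷ 0F ∷ 7F ∷ 6F ∷ 9F ∷ 8F ∷ []) (9F ∷ 4F ∷ 3F ∷ 2F ∷ 1F ∷ 6F ∷ 5F ∷ 8F ∷ 7F ∷ 0F ∷ [])
  ∷ switching ((1F , 2F) ∷ (0F , 7F) ∷ (1F , 4F) ∷ [])
      (9F ∷ 6F ∷ 3F ∷ 2F ∷ 5F ∷ 4F ∷ 1F ∷ 8F ∷ 7F ∷ 0F ∷ []) (9F ∷ 4F ∷ 3F ∷ 2F ∷ 1F ∷ 6F ∷ 5F ∷ 8F ∷ 7F ∷ 0F ∷ [])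
  ∷ switching ((1F , 2F) ∷ (0F , 7F) ∷ (0F , 5F) ∷ [])
      (7F ∷ 4F ∷ 3F ∷ 2F ∷ 1F ∷ 6F ∷ 5F ∷ 0F ∷ 9F ∷ 8F ∷ []) (9F ∷ 4F ∷ 3F ∷ 2F ∷ 1F ∷ 6F ∷ 5F ∷ 8F ∷ 7F ∷ 0F ∷ [])
  ∷ switching ((1F , 2F) ∷ (0F , 7F) ∷ (1F , 6F) ∷ [])
      (9F ∷ 8F ∷ 3F ∷ 2F ∷ 5F ∷ 4F ∷ 7F ∷ 6F ∷ 1F ∷ 0F ∷ []) (9F ∷ 4F ∷ 3F ∷ 2F ∷ 1F ∷ 6F ∷ 5F ∷ 8F ∷ 7F ∷ 0F ∷ [])
  ∷ []

switchings-valid : All (λ c → Valid σ₁₀ τ₁₀ (certificate₁₀ c)) switchings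
switchings-valid = all⁺ (isValid σ₁₀ τ₁₀ ∘ certificate₁₀) switchings _

covered : Attachment → Bool
covered att = any (λ c → appliesTo c att) switchings

trues : ∀ {k} → Vec Bool k → ℕ
trues []      = 0
trues (b ∷ v) = 𝟙 b + trues v

trues-tabulate : ∀ {k} (f : Fin k → Bool) → trues (V.tabulate f) ≡ sum (𝟙 ∘ f)
trues-tabulate {zero}  f = refl
trues-tabulate {suc k} f = cong (𝟙 (f zero) +_) (trues-tabulate (f ∘ suc))

weight : Attachment → ℕ
weight att = trues (lookup att 0F) + trues (lookup att 1F)

-- avoids b v: v vanishes at all positions l with isOdd l ≡ b.
avoids : ∀ {k} → Bool → Vec Bool k → Bool
avoids b []      = true
avoids b (a ∷ v) = (b ∨ not a) ∧ avoids (not b) v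

avoids-tabulate : ∀ {k} b (f : Fin k → Bool) → (∀ l → isOdd (toℕ l) ≡ b → f l ≡ false) → T (avoids b (V.tabulate f))
avoids-tabulate {zero}  b f _      = _
avoids-tabulate {suc k} b f vanish =
  T-∧⁺ (b ∨ not (f zero)) (head b (vanish zero)) (avoids-tabulate (not b) (f ∘ suc) (λ l odd → vanish (suc l) (trans (cong not odd) (not-involutive b))))
  where
  head : ∀ b → (false ≡ b → f zero ≡ false) → T (b ∨ not (f zero))
  head true  _ = _
  head false v rewrite v refl = _

-- The two outside vertices lie on opposite sides, each without neighbours on its own side of the cycle.
bipartite-compatible : Attachment → Bool
bipartite-compatible att = any (λ b → avoids b (lookup att 0F) ∧ avoids (not b) (lookup att 1F)) (true ∷ false ∷ [])

admissible : Attachment → Bool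
admissible att = (9 ≤ᵇ weight att) ∨ ((5 ≤ᵇ weight att) ∧ bipartite-compatible att)

vectors : ∀ {a} {A : Set a} → List A → (k : ℕ) → List (Vec A k)
vectors xs zero    = [] ∷ []
vectors xs (suc k) = cartesianProductWith _∷_ xs (vectors xs k)

∈-vectors : ∀ {a} {A : Set a} {xs : List A} {k} (v : Vec A k) → (∀ i → lookup v i ∈ xs) → v ∈ vectors xs k
∈-vectors []      _  = here refl
∈-vectors (x ∷ v) v⊆ = ∈-cartesianProductWith⁺ _∷_ (v⊆ zero) (∈-vectors v (v⊆ ∘ suc))

heavy⇒admissible : ∀ att → 9 ≤ weight att → T (admissible att)
heavy⇒admissible att heavy = T-∨ˡ (9 ≤ᵇ weight att) _ (≤⇒≤ᵇ heavy)

compatible⇒admissible : ∀ att → 5 ≤ weight att → T (bipartite-compatible att) → T (admissible att)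
compatible⇒admissible att heavy compatible = T-∨ʳ (9 ≤ᵇ weight att) (T-∧⁺ (5 ≤ᵇ weight att) (≤⇒≤ᵇ heavy) compatible)

admissible⇒coveredᵇ : Attachment → Bool
admissible⇒coveredᵇ att = not (admissible att) ∨ covered att

-- Opaque, so that the exhaustive check is evaluated exactly once.
opaque
  attachments : List Attachment
  attachments = vectors (vectors (true ∷ false ∷ []) 8) 2

  ∈-attachments : ∀ att → att ∈ attachments
  ∈-attachments att = ∈-vectors att (λ i → ∈-vectors (lookup att i) (bool∈ ∘ lookup (lookup att i)))
    where
    bool∈ : ∀ b → b ∈ true ∷ false ∷ []
    bool∈ true  = here refl
    bool∈ false = there (here refl)

  admissible⇒covered-by-exhaustion : T (all admissible⇒coveredᵇ attachments)
  admissible⇒covered-by-exhaustion = _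

admissible⇒covered : ∀ att → T (admissible att) → T (covered att)
admissible⇒covered att adm =
  T-⇒ (admissible att) adm (All.lookup (all⁺ admissible⇒coveredᵇ attachments admissible⇒covered-by-exhaustion) (∈-attachments att))

module OnCycle8 {n : ℕ} {G : Graph n} {M M′ : PerfectMatching G} (C : Cycle8 M M′) where

  open Cycle8 C

  cycle-edge : ∀ k → adj G (φ k) (φ (next k)) ≡ true
  cycle-edge k with next-on-cycle k
  ... | inj₁ eq = subst (λ l → adj G (φ k) (φ l) ≡ true) (sym eq) (represented-adj M∼σ₈ k)
  ... | inj₂ eq = subst (λ l → adj G (φ k) (φ l) ≡ true) (sym eq) (represented-adj M′∼τ₈ k)

  NoChord : Set
  NoChord = ∀ k → adj G (φ k) (φ (k ⊕ 3)) ≡ false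

  switch-at-chord : ∀ k → adj G (φ k) (φ (k ⊕ 3)) ≡ true → Star Switch3 M M′
  switch-at-chord k chord = switch-by-certificate M M′ M∼σ₈ M′∼τ₈ agree (chordCertificate k) (chordCertificate-valid k) (chord ∷ [])

  switch-unless-NoChord : (NoChord → Star Switch3 M M′) → Star Switch3 M M′
  switch-unless-NoChord on-no-chord with any? (λ k → adj G (φ k) (φ (k ⊕ 3)) Bool.≟ true)
  ... | yes (k , chord) = switch-at-chord k chord
  ... | no  no-chord    = on-no-chord (λ k → ¬-not (λ chord → no-chord (k , chord)))

  private
    p : Fin n → Fin n
    p = partner M

  cycleDegree : Fin n → ℕ
  cycleDegree u = sum (λ l → 𝟙 (adj G u (φ l)))

  outsideCount : ℕ
  outsideCount = sum (λ u → 𝟙 (outside u))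

  cycleDegrees : ℕ
  cycleDegrees = sum (λ k → cycleDegree (φ k))

  crossEdges : ℕ
  crossEdges = sum (λ u → 𝟙 (outside u) * cycleDegree u)

  8+outsideCount : 8 + outsideCount ≡ n
  8+outsideCount = sym (trans (sym (trans (sum-const n 1) (*-identityʳ n))) (trans (sum-frame (λ _ → 1)) (cong (8 +_) (sum-cong-≗ (λ u → *-identityʳ (𝟙 (outside u)))))))

  degree-sum : sum (λ k → deg G (φ k)) ≡ cycleDegrees + crossEdges
  degree-sum = begin
    sum (λ k → deg G (φ k))
      ≡⟨ sum-cong-≗ (λ k → trans (count≡sum (adj G (φ k))) (sum-frame (λ u → 𝟙 (adj G (φ k) u)))) ⟩
    sum (λ k → cycleDegree (φ k) + sum (λ u → 𝟙 (outside u) * 𝟙 (adj G (φ k) u)))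
      ≡⟨ ∑-distrib-+ (λ k → cycleDegree (φ k)) (λ k → sum (λ u → 𝟙 (outside u) * 𝟙 (adj G (φ k) u))) ⟩
    sum (λ k → cycleDegree (φ k)) + sum (λ k → sum (λ u → 𝟙 (outside u) * 𝟙 (adj G (φ k) u)))
      ≡⟨ cong (sum (λ k → cycleDegree (φ k)) +_) (trans (∑-comm (λ k u → 𝟙 (outside u) * 𝟙 (adj G (φ k) u))) (sum-cong-≗ from-outside)) ⟩
    sum (λ k → cycleDegree (φ k)) + crossEdges
      ∎
    where
    open ≡-Reasoning
    from-outside : ∀ u → sum (λ k → 𝟙 (outside u) * 𝟙 (adj G (φ k) u)) ≡ 𝟙 (outside u) * cycleDegree u
    from-outside u = trans (sum-cong-≗ (λ k → cong (λ b → 𝟙 (outside u) * 𝟙 b) (adj-sym G (φ k) u)))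
                           (sym (*-distribˡ-sum (𝟙 (outside u)) (λ k → 𝟙 (adj G u (φ k)))))

  Inside-partner : ∀ {u} → Inside u → Inside (p u)
  Inside-partner (k , refl) = σ₈ k , sym (on-frame M∼σ₈ k)

  outside-partner : ∀ u → outside (p u) ≡ outside u
  outside-partner u with inside? u | inside? (p u)
  ... | yes _   | yes _    = refl
  ... | no  _   | no  _    = refl
  ... | yes u∈φ | no  pu∉φ = ⊥-elim (pu∉φ (Inside-partner u∈φ))
  ... | no  u∉φ | yes pu∈φ = ⊥-elim (u∉φ (subst Inside (partner-involutive M u) (Inside-partner pu∈φ)))

  -- M pairs up the outside vertices, so summing over the outside M-edges counts every cross edge twice.
  outside-pair-sum : sum (λ u → 𝟙 (outside u) * (cycleDegree u + cycleDegree (p u))) ≡ crossEdges + crossEdges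
  outside-pair-sum = begin
    sum (λ u → 𝟙 (outside u) * (cycleDegree u + cycleDegree (p u)))
      ≡⟨ sum-cong-≗ (λ u → *-distribˡ-+ (𝟙 (outside u)) (cycleDegree u) (cycleDegree (p u))) ⟩
    sum (λ u → 𝟙 (outside u) * cycleDegree u + 𝟙 (outside u) * cycleDegree (p u))
      ≡⟨ ∑-distrib-+ (λ u → 𝟙 (outside u) * cycleDegree u) (λ u → 𝟙 (outside u) * cycleDegree (p u)) ⟩
    crossEdges + sum (λ u → 𝟙 (outside u) * cycleDegree (p u))
      ≡⟨ cong (crossEdges +_) (trans (sum-cong-≗ (λ u → cong (λ b → 𝟙 b * cycleDegree (p u)) (sym (outside-partner u))))
                                     (sym (∑-permute (λ u → 𝟙 (outside u) * cycleDegree u) p-permutation))) ⟩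
    crossEdges + crossEdges
      ∎
    where
    open ≡-Reasoning
    p-permutation : Permutation′ n
    p-permutation = permutation p p (partner-involutive M) (partner-involutive M)

  heavy-outside-edge : ∀ K → K * outsideCount < crossEdges + crossEdges →
                       ∃[ x ] (¬ Inside x × K < cycleDegree x + cycleDegree (p x))
  heavy-outside-edge K K*count< with sum-<⇒∃< {f = λ u → 𝟙 (outside u) * K} {g = λ u → 𝟙 (outside u) * (cycleDegree u + cycleDegree (p u))}
                                       (subst₂ _<_ K*count≡ (sym outside-pair-sum) K*count<)
    where
    K*count≡ : K * outsideCount ≡ sum (λ u → 𝟙 (outside u) * K)
    K*count≡ = trans (*-distribˡ-sum K (λ u → 𝟙 (outside u))) (sum-cong-≗ (λ u → *-comm K (𝟙 (outside u))))
  ... | x , heavier with outside x in out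
  ...   | true  = x , outside⇒∉ out , subst₂ _<_ (+-identityʳ K) (+-identityʳ _) heavier
  ...   | false with () ← heavier

  module Attached (x : Fin n) (x-outside : ¬ Inside x) where

    y : Fin n
    y = p x

    y-outside : ¬ Inside y
    y-outside y∈φ = x-outside (subst Inside (partner-involutive M x) (Inside-partner y∈φ))

    φ₁₀ : Fin 10 → Fin n
    φ₁₀ 0F            = x
    φ₁₀ 1F            = y
    φ₁₀ (suc (suc k)) = φ k

    φ₁₀-injective : ∀ {k l} → φ₁₀ k ≡ φ₁₀ l → k ≡ l
    φ₁₀-injective {0F}          {0F}          _  = refl
    φ₁₀-injective {0F}          {1F}          eq = ⊥-elim (partner-≢ M x (sym eq))
    φ₁₀-injective {0F}          {suc (suc l)} eq = ⊥-elim (x-outside (l , sym eq))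
    φ₁₀-injective {1F}          {0F}          eq = ⊥-elim (partner-≢ M x eq)
    φ₁₀-injective {1F}          {1F}          _  = refl
    φ₁₀-injective {1F}          {suc (suc l)} eq = ⊥-elim (y-outside (l , sym eq))
    φ₁₀-injective {suc (suc k)} {0F}          eq = ⊥-elim (x-outside (k , eq))
    φ₁₀-injective {suc (suc k)} {1F}          eq = ⊥-elim (y-outside (k , eq))
    φ₁₀-injective {suc (suc k)} {suc (suc l)} eq = cong (2 ↑ʳ_) (φ-injective eq)

    module Frame₁₀ = Framed {G = G} φ₁₀ φ₁₀-injective

    M∼σ₁₀ : Represents φ₁₀ M σ₁₀
    M∼σ₁₀ = represents λ { 0F → refl ; 1F → partner-involutive M x ; (suc (suc k)) → on-frame M∼σ₈ k }

    M′∼τ₁₀ : Represents φ₁₀ M′ τ₁₀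
    M′∼τ₁₀ = represents λ { 0F → sym (agree x x-outside)
                          ; 1F → trans (sym (agree y y-outside)) (partner-involutive M x)
                          ; (suc (suc k)) → on-frame M′∼τ₈ k }

    agree₁₀ : ∀ u → ¬ Frame₁₀.Inside u → partner M u ≡ partner M′ u
    agree₁₀ u u∉φ₁₀ = agree u (λ (k , φk≡u) → u∉φ₁₀ (suc (suc k) , φk≡u))

    attachment : Attachment
    attachment = V.tabulate (λ i → V.tabulate (λ l → adj G (φ₁₀ (i ↑ˡ 8)) (φ l)))

    attachment-entry : ∀ i l → lookup (lookup attachment i) l ≡ adj G (φ₁₀ (i ↑ˡ 8)) (φ l)
    attachment-entry i l = trans (cong (λ row → lookup row l) (lookup∘tabulate (λ i → V.tabulate (λ l → adj G (φ₁₀ (i ↑ˡ 8)) (φ l))) i))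
                                 (lookup∘tabulate (λ l → adj G (φ₁₀ (i ↑ˡ 8)) (φ l)) l)

    weight-attachment : weight attachment ≡ cycleDegree x + cycleDegree y
    weight-attachment = cong₂ _+_ (trues-tabulate (λ l → adj G x (φ l))) (trues-tabulate (λ l → adj G y (φ l)))

    switch-if-covered : T (covered attachment) → Star Switch3 M M′
    switch-if-covered cov with find (any⁻ (λ c → appliesTo c attachment) switchings cov)
    ... | c , c∈ , applies = Frame₁₀.switch-by-certificate M M′ M∼σ₁₀ M′∼τ₁₀ agree₁₀ (certificate₁₀ c) (All.lookup switchings-valid c∈)
                               (map⁺ (All.map (λ {e} → attached-edge {e}) (all⁺ _ (uses c) applies)))
      where
      attached-edge : ∀ {e} → T (lookup (lookup attachment (proj₁ e)) (proj₂ e)) → adj G (φ₁₀ (proj₁ e ↑ˡ 8)) (φ₁₀ (2 ↑ʳ proj₂ e)) ≡ true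
      attached-edge {i , l} att-il = trans (sym (attachment-entry i l)) (T⇒≡true att-il)

    switch-if-admissible : T (admissible attachment) → Star Switch3 M M′
    switch-if-admissible = switch-if-covered ∘ admissible⇒covered attachment

    switch-if-heavy : 8 < cycleDegree x + cycleDegree y → Star Switch3 M M′
    switch-if-heavy heavy = switch-if-admissible (heavy⇒admissible attachment (subst (9 ≤_) (sym weight-attachment) heavy))

    switch-if-compatible : 4 < cycleDegree x + cycleDegree y → T (bipartite-compatible attachment) → Star Switch3 M M′
    switch-if-compatible heavy compatible =
      switch-if-admissible (compatible⇒admissible attachment (subst (5 ≤_) (sym weight-attachment) heavy) compatible)

  cycleDegree-≤ : ∀ js k → All (λ j → adj G (φ k) (φ (k ⊕ j)) ≡ false) js → cycleDegree (φ k) ≤ freePositions js k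
  cycleDegree-≤ js k non-adjacent = sum-mono-≤ pointwise
    where
    hole-non-adjacent : ∀ {l} js → All (λ j → adj G (φ k) (φ (k ⊕ j)) ≡ false) js → T (holes js k l) → adj G (φ k) (φ l) ≡ false
    hole-non-adjacent {l} (j ∷ js) (kj ∷ rest) hole with l ≟ k ⊕ j
    ... | yes refl = kj
    ... | no  _    = hole-non-adjacent js rest hole
    pointwise : ∀ l → 𝟙 (adj G (φ k) (φ l)) ≤ 𝟙 (not (holes js k l))
    pointwise l = 𝟙-≤-𝟙-not (adj G (φ k) (φ l)) (holes js k l) (hole-non-adjacent js non-adjacent)

  chord-degrees : ∀ {K} → (∀ k → K ≤ deg G (φ k) + deg G (φ (k ⊕ 3))) → 4 * K ≤ sum (λ k → deg G (φ k))
  chord-degrees {K} K≤ = subst₂ _≤_ (sum-const 4 K) (sym (sum-by-chords (λ k → deg G (φ k)))) (sum-mono-≤ (K≤ ∘ evens))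

  module _ (no-chord : NoChord) where

    no-chord-back : ∀ k → adj G (φ k) (φ (k ⊕ 5)) ≡ false
    no-chord-back k = trans (adj-sym G (φ k) (φ (k ⊕ 5)))
      (subst (λ l → adj G (φ (k ⊕ 5)) (φ l) ≡ false) (trans (⊕-+ k 5 3) (⊕-8 k)) (no-chord (k ⊕ 5)))

    ore-crossEdges : OreCondition G (n + 3) → 8 * outsideCount < crossEdges + crossEdges
    ore-crossEdges ore = ore-count outsideCount cycleDegrees crossEdges
      (subst (λ m → 4 * (m + 3) ≤ cycleDegrees + crossEdges) (sym 8+outsideCount)
        (subst (4 * (n + 3) ≤_) degree-sum (chord-degrees (λ k → ore (φ k) (φ (k ⊕ 3)) (⊕3-≢ k ∘ φ-injective) (no-chord k)))))
      (subst (cycleDegrees ≤_) (sum-const 8 5) (sum-mono-≤ cycleDegree-≤5))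
      where
      cycleDegree-≤5 : ∀ k → cycleDegree (φ k) ≤ 5
      cycleDegree-≤5 k = subst (cycleDegree (φ k) ≤_) (freePositions-ore k)
        (cycleDegree-≤ (0 ∷ 3 ∷ 5 ∷ []) k (irrefl G (φ k) ∷ no-chord k ∷ no-chord-back k ∷ []))

    ore-switch : OreCondition G (n + 3) → Star Switch3 M M′
    ore-switch ore = switch-at (heavy-outside-edge 8 (ore-crossEdges ore))
      where
      switch-at : ∃[ x ] (¬ Inside x × 8 < cycleDegree x + cycleDegree (p x)) → Star Switch3 M M′
      switch-at (x , x-outside , heavy) = Attached.switch-if-heavy x x-outside heavy

  module Bipartite (side : Fin n → Bool) (bipartite : ∀ u v → adj G u v ≡ true → side u ≢ side v) where

    same-side-non-adjacent : ∀ {u v} → side u ≡ side v → adj G u v ≡ false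
    same-side-non-adjacent {u} {v} su≡sv with adj G u v in uv
    ... | false = refl
    ... | true  = ⊥-elim (bipartite u v uv su≡sv)

    side-along : ∀ k j → side (φ (k ⊕ j)) ≡ side (φ k) xor isOdd j
    side-along k zero    = sym (xor-identityʳ _)
    side-along k (suc j) = trans (side-along (next k) j) (trans (cong (_xor isOdd j) side-next) (not-xor (side (φ k)) (isOdd j)))
      where
      side-next : side (φ (next k)) ≡ not (side (φ k))
      side-next = ¬-not (λ eq → bipartite _ _ (cycle-edge k) (sym eq))

    same-side-along : ∀ k j → isOdd j ≡ false → adj G (φ k) (φ (k ⊕ j)) ≡ false
    same-side-along k j even = same-side-non-adjacent (sym (trans (side-along k j) (trans (cong (side (φ k) xor_) even) (xor-identityʳ _))))

    chord-sides : ∀ k → side (φ k) ≢ side (φ (k ⊕ 3))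
    chord-sides k eq = not-¬ refl (trans eq (trans (side-along k 3) (xor-true (side (φ k)))))

    side-on-cycle : ∀ l → side (φ l) ≡ side (φ 0F) xor isOdd (toℕ l)
    side-on-cycle l = subst (λ k → side (φ k) ≡ side (φ 0F) xor isOdd (toℕ l)) (0F⊕toℕ l) (side-along 0F (toℕ l))

    -- x avoids the cycle vertices of parity side (φ 0) xor side x, its partner the others.
    attachment-compatible : ∀ x x-outside → T (bipartite-compatible (Attached.attachment x x-outside))
    attachment-compatible x x-outside = any⁺ _ (at (side (φ 0F) xor side x) refl)
      where
      side-partner : side (p x) ≡ not (side x)
      side-partner = ¬-not (λ eq → bipartite x (p x) (partner-adj M x) (sym eq))
      both : ∀ b → b ≡ side (φ 0F) xor side x →
             T (avoids b (V.tabulate (λ l → adj G x (φ l))) ∧ avoids (not b) (V.tabulate (λ l → adj G (p x) (φ l))))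
      both b refl = T-∧⁺ _ (avoids-tabulate b _ (λ l odd → same-side-non-adjacent (sym (own-x l odd))))
                           (avoids-tabulate (not b) _ (λ l odd → same-side-non-adjacent (sym (own-y l odd))))
        where
        own-x : ∀ l → isOdd (toℕ l) ≡ side (φ 0F) xor side x → side (φ l) ≡ side x
        own-x l odd = trans (side-on-cycle l) (trans (cong (side (φ 0F) xor_) odd) (xor-cancel (side (φ 0F)) (side x)))
        own-y : ∀ l → isOdd (toℕ l) ≡ not (side (φ 0F) xor side x) → side (φ l) ≡ side (p x)
        own-y l odd = trans (side-on-cycle l) (trans (cong (side (φ 0F) xor_) odd) (trans (xor-not-cancel (side (φ 0F)) (side x)) (sym side-partner)))
      at : ∀ b → b ≡ side (φ 0F) xor side x →
           Any (λ b → T (avoids b (V.tabulate (λ l → adj G x (φ l))) ∧ avoids (not b) (V.tabulate (λ l → adj G (p x) (φ l)))))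
               (true ∷ false ∷ [])
      at true  eq = here (both true eq)
      at false eq = there (here (both false eq))

    module _ (no-chord : NoChord) (h : ℕ) (n≡2h : n ≡ h + h)
             (bipartite-ore : ∀ u v → side u ≢ side v → adj G u v ≡ false → h + 1 ≤ deg G u + deg G v) where

      bipartite-crossEdges : 4 * outsideCount < crossEdges + crossEdges
      bipartite-crossEdges = bipartite-count h outsideCount cycleDegrees crossEdges
        (trans 8+outsideCount n≡2h)
        (subst (4 * (h + 1) ≤_) degree-sum (chord-degrees (λ k → bipartite-ore (φ k) (φ (k ⊕ 3)) (chord-sides k) (no-chord k))))
        (subst (cycleDegrees ≤_) (sum-const 8 2) (sum-mono-≤ cycleDegree-≤2))
        where
        cycleDegree-≤2 : ∀ k → cycleDegree (φ k) ≤ 2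
        cycleDegree-≤2 k = subst (cycleDegree (φ k) ≤_) (freePositions-bipartite k)
          (cycleDegree-≤ (0 ∷ 2 ∷ 4 ∷ 6 ∷ 3 ∷ 5 ∷ []) k
             (irrefl G (φ k) ∷ same-side-along k 2 refl ∷ same-side-along k 4 refl ∷ same-side-along k 6 refl
              ∷ no-chord k ∷ no-chord-back no-chord k ∷ []))

      bipartite-switch : Star Switch3 M M′
      bipartite-switch = switch-at (heavy-outside-edge 4 bipartite-crossEdges)
        where
        switch-at : ∃[ x ] (¬ Inside x × 4 < cycleDegree x + cycleDegree (p x)) → Star Switch3 M M′
        switch-at (x , x-outside , heavy) = Attached.switch-if-compatible x x-outside heavy (attachment-compatible x x-outside)


lemma3p4 : ((n : ℕ) (G : Graph n) → OreCondition G (n + 3) → Conclusion G)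
    × ((n : ℕ) (G : Graph (n + n)) (side : Fin (n + n) → Bool) → BalancedBipartition n G side → BipOreCondition n G side (n + 1) → Conclusion G)
lemma3p4 = ore-case , bipartite-case
  where
  ore-case : (n : ℕ) (G : Graph n) → OreCondition G (n + 3) → Conclusion G
  ore-case n G ore M M′ ≤8 = reduce-to-cycle8 M M′ (subst (_≤ 8) (symDiff≡hamming M M′) ≤8)
    λ C → OnCycle8.switch-unless-NoChord C λ no-chord → OnCycle8.ore-switch C no-chord ore
  bipartite-case : (h : ℕ) (G : Graph (h + h)) (side : Fin (h + h) → Bool) →
                   BalancedBipartition h G side → BipOreCondition h G side (h + 1) → Conclusion G
  bipartite-case h G side (_ , bipartite) bipartite-ore M M′ ≤8 = reduce-to-cycle8 M M′ (subst (_≤ 8) (symDiff≡hamming M M′) ≤8)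
    λ C → OnCycle8.switch-unless-NoChord C λ no-chord →
            OnCycle8.Bipartite.bipartite-switch C side bipartite no-chord h refl bipartite-ore
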